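{- Let $a^\circ_{n,k}(1342)$ be the number of cyclic permutations $\pi\in\mathfrak S_n$ whose one-line notation avoids $\delta_k=k(k-1)\cdots21$ and such that every cyclic rotation of the cycle form $C(\pi)$ avoids $1342$, and let $b^\circ_{n,k}(1342)$ be the number of these with $\pi_1=n$. Then for $n\ge5$ and $k\ge4$, \[a^\circ_{n,k}(1342)=a^\circ_{n-1,k}(1342)+b^\circ_{n,k}(1342)+\sum_{r=3}^{n-1}b^\circ_{r,k-1}(1342).\]
   Context: A permutation $\pi\in\mathfrak S_n$ is cyclic if it is a single $n$-cycle. Its cycle form is $C(\pi)=(1,c_2,\dots,c_n)$ with $c_2=\pi(1)$, $c_{i+1}=\pi(c_i)$. The cyclic rotations of $C(\pi)$ are the sequences $c_i,\dots,c_n,c_1,\dots,c_{i-1}$ (with $c_1=1$). A sequence avoids $\sigma\in\mathfrak S_m$ if no length-$m$ subsequence is order-isomorphic to $\sigma$. One-line notation: $\pi_1\cdots\pi_n$ with $\pi_i=\pi(i)$. -}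

module Defs where

open import Data.Nat using (ℕ; zero; suc; _+_; _∸_; _<ᵇ_; _≡ᵇ_)
open import Data.Bool using (Bool; true; false; _∧_; _∨_; not; if_then_else_)
open import Data.List using (List; []; _∷_; map; concatMap; length; filter; take; drop; _++_; upTo; zip; downFrom; head; lookup)
open import Data.Bool.ListAction using (all; any)
open import Data.Nat.ListAction using (sum)
open import Data.Product using (_,_)
open import Data.Bool.Properties using () renaming (_≟_ to _≟B_)
open import Relation.Binary.PropositionalEquality using (_≡_)

-- Words / permutations are lists of naturals; a permutation of [n] in
-- one-line notation is the list π₁ ⋯ πₙ with values in {1,…,n}.

_==_ : Bool → Bool → Bool
true  == b = b
false == b = not b

words : ℕ → ℕ → List (List ℕ)
words n zero    = [] ∷ []
words n (suc m) = concatMap (λ v → map (v ∷_) (words n m)) (map suc (upTo n))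

distinct : List ℕ → Bool
distinct []       = true
distinct (x ∷ xs) = not (any (x ≡ᵇ_) xs) ∧ distinct xs

perms : ℕ → List (List ℕ)
perms n = filter (λ l → distinct l ≟B true) (words n n)

-- π(i) for i ∈ {1,…,n}, π given in one-line notation (0 if out of range)
app : List ℕ → ℕ → ℕ
app []       _             = 0
app (x ∷ xs) zero          = 0
app (x ∷ xs) (suc zero)    = x
app (x ∷ xs) (suc (suc i)) = app xs (suc i)

orbit : List ℕ → ℕ → ℕ → List ℕ
orbit π zero    c = []
orbit π (suc m) c = c ∷ orbit π m (app π c)

cycleForm : List ℕ → List ℕ
cycleForm π = orbit π (length π) 1

-- π is cyclic (a single n-cycle) iff the orbit of 1 has n distinct elements
isCyclic : List ℕ → Bool
isCyclic π = distinct (cycleForm π)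

subseqs : ℕ → List ℕ → List (List ℕ)
subseqs zero    _        = [] ∷ []
subseqs (suc m) []       = []
subseqs (suc m) (x ∷ xs) = map (x ∷_) (subseqs m xs) ++ subseqs (suc m) xs

orderIso : List ℕ → List ℕ → Bool
orderIso []       []       = true
orderIso []       (_ ∷ _)  = false
orderIso (_ ∷ _)  []       = false
orderIso (x ∷ xs) (y ∷ ys) =
  all (λ { (x' , y') → ((x <ᵇ x') == (y <ᵇ y')) ∧ ((x' <ᵇ x) == (y' <ᵇ y)) }) (zip xs ys)
  ∧ orderIso xs ys

contains : List ℕ → List ℕ → Bool
contains σ s = any (λ t → orderIso t σ) (subseqs (length σ) s)

avoids : List ℕ → List ℕ → Bool
avoids σ s = not (contains σ s)

rotations : List ℕ → List (List ℕ)
rotations c = map (λ i → drop i c ++ take i c) (upTo (length c))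

δ : ℕ → List ℕ
δ k = map suc (downFrom k)

p1342 : List ℕ
p1342 = 1 ∷ 3 ∷ 4 ∷ 2 ∷ []

good : ℕ → List ℕ → Bool
good k π = isCyclic π ∧ avoids (δ k) π ∧ all (avoids p1342) (rotations (cycleForm π))

firstIs : ℕ → List ℕ → Bool
firstIs n []      = false
firstIs n (x ∷ _) = x ≡ᵇ n

aCirc : ℕ → ℕ → ℕ
aCirc n k = length (filter (λ π → good k π ≟B true) (perms n))

bCirc : ℕ → ℕ → ℕ
bCirc n k = length (filter (λ π → (good k π ∧ firstIs n π) ≟B true) (perms n))

sumFromTo : ℕ → ℕ → (ℕ → ℕ) → ℕ
sumFromTo lo hi f = sum (map f (drop lo (upTo (suc hi))))

{-# OPTIONS --safe #-}
-- Sort the permutations counted by a°_{n,k} by their first entry v = π₁.  None has v = 1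
-- (1 would be a fixed point), and those with v = n are counted by b°_{n,k}.
-- For v = 2 the cycle form starts 1 2; deleting the 2 and relabelling is a bijection onto
-- the permutations counted by a°_{n-1,k}.
-- For 3 ≤ v = r < n, cyclic 1342-avoidance forces C(π) = C(σ) n (n-1) ⋯ (r+1) for a
-- permutation σ of [r] with σ₁ = r; in one-line notation π is σ with 1 replaced by n,
-- followed by 1 (r+1) ⋯ (n-1).  Since 1 precedes 2 in σ, the longest decreasing
-- subsequence grows by exactly one, so these π correspond to those counted by b°_{r,k-1}.
module Submission where

open import Defs
open import Data.Bool using (Bool; true; false; T; not; _∧_)
open import Data.Bool.ListAction using (all; any)
open import Data.Bool.Properties using (T-≡; ∧-comm) renaming (_≟_ to _≟B_)
open import Data.Empty using (⊥; ⊥-elim)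
open import Data.List
  using (List; []; _∷_; _++_; map; length; filter; zip; take; drop; upTo; downFrom; concatMap;
         applyUpTo; applyDownFrom; initLast; _∷ʳ′_)
open import Data.List.Membership.Propositional using (_∈_; _∉_; find; lose)
open import Data.List.Membership.Propositional.Properties
  using (∈-map⁺; ∈-map⁻; ∈-++⁺ˡ; ∈-++⁺ʳ; ∈-++⁻; ∈-∃++; ∈-upTo⁺; ∈-upTo⁻; ∈-filter⁺; ∈-filter⁻;
         ∈-concatMap⁺; ∈-concatMap⁻; ∈-applyUpTo⁺; ∈-applyUpTo⁻; ∈-applyDownFrom⁻)
open import Data.List.Properties
  using (length-map; length-++; length-take; length-drop; length-upTo; length-downFrom;
         length-applyUpTo; length-applyDownFrom; take++drop≡id; ++-assoc; ∷-injective; ∷-injectiveˡ;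
         ∷-injectiveʳ; ∷ʳ-injectiveʳ; map-∘; map-cong; map-cong-local; map-id-local)
open import Data.List.Relation.Binary.Sublist.Propositional
  using (_⊆_; []; _∷_; _∷ʳ_; minimum; ⊆-refl; ⊆-trans; lookup; from∈)
open import Data.List.Relation.Binary.Sublist.Propositional.Properties
  using (take-⊆; ++⁺; ++⁺ˡ; ++⁺ʳ; ∷ˡ⁻; map⁺; length-mono-≤; All-resp-⊆)
open import Data.List.Relation.Unary.All as All using (All; []; _∷_)
open import Data.List.Relation.Unary.All.Properties
  using (all⁺; all⁻; ¬Any⇒All¬; All¬⇒¬Any; applyUpTo⁺₁) renaming (++⁺ to All-++⁺)
open import Data.List.Relation.Unary.AllPairs as AllPairs using (AllPairs; []; _∷_)
import Data.List.Relation.Unary.AllPairs.Properties as AllPairs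
open import Data.List.Relation.Unary.Any using (here; there)
open import Data.List.Relation.Unary.Any.Properties using (any⁺; any⁻)
open import Data.List.Relation.Unary.Unique.Propositional using (Unique)
import Data.List.Relation.Unary.Unique.Propositional.Properties as Unique
open import Data.Nat
  using (ℕ; zero; suc; _+_; _∸_; _⊓_; _<_; _>_; _≤_; z≤n; s≤s; _<ᵇ_; _≡ᵇ_; _≟_; _≤?_)
open import Data.Nat.ListAction using (sum)
open import Data.Nat.Properties
  using (<ᵇ⇒<; <⇒<ᵇ; ≡⇒≡ᵇ; ≡ᵇ⇒≡; ≤-refl; ≤-reflexive; ≤-trans; ≤-antisym; ≤-pred; <-irrefl; <-asym;
         <-trans; <-≤-trans; ≤-<-trans; <-cmp; <⇒≤; ≤∧≢⇒<; ≰⇒>; m≤n⇒m<n∨m≡n; m≤n⇒m≤1+n; n≤1+n;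
         suc-injective; 0≢1+n; +-suc; +-comm; +-assoc; +-identityʳ; +-cancelʳ-≡; +-cancelˡ-<;
         +-monoʳ-≤; +-monoʳ-<; m≤m+n; m<m+n; m+[n∸m]≡n; m+n∸m≡n; m≤n⇒m⊓n≡m; module ≤-Reasoning)
open import Algebra.Properties.CommutativeSemigroup Data.Nat.Properties.+-commutativeSemigroup
  using () renaming (interchange to +-interchange)
open import Data.Product using (_×_; _,_; proj₁; proj₂; ∃₂; ∃-syntax)
open import Data.Sum using (_⊎_; inj₁; inj₂)
import Data.Sum as Sum
open import Function using (_∘_; _⇔_; mk⇔)
open import Function.Bundles using (module Equivalence)
open import Relation.Binary.Core using (_Preserves_⟶_)
open import Relation.Binary.Definitions using (tri<; tri≈; tri>)
open import Relation.Binary.PropositionalEquality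
  using (_≡_; _≢_; refl; sym; trans; cong; cong₂; subst; module ≡-Reasoning)
open import Relation.Nullary using (¬_; yes; no)
open import Data.List.Membership.DecPropositional _≟_ using (_∈?_)

open Equivalence using (to; from)

T-not⇒¬T : ∀ {b} → T (not b) → ¬ T b
T-not⇒¬T {false} _ ()

¬T⇒T-not : ∀ {b} → ¬ T b → T (not b)
¬T⇒T-not {false} _ = _
¬T⇒T-not {true} ¬t = ¬t _

T-∧⁺ : ∀ {a b} → T a → T b → T (a ∧ b)
T-∧⁺ {true} _ tb = tb

T-∧⁻ˡ : ∀ {a b} → T (a ∧ b) → T a
T-∧⁻ˡ {true} _ = _

T-∧⁻ʳ : ∀ {a b} → T (a ∧ b) → T b
T-∧⁻ʳ {true} tb = tb

distinct⁻ : ∀ xs → T (distinct xs) → Unique xs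
distinct⁻ []       _ = []
distinct⁻ (x ∷ xs) h =
  All.map (λ ¬x≡y x≡y → ¬x≡y (≡⇒≡ᵇ x _ x≡y)) (¬Any⇒All¬ xs (T-not⇒¬T (T-∧⁻ˡ h) ∘ any⁺ (x ≡ᵇ_)))
  ∷ distinct⁻ xs (T-∧⁻ʳ h)

distinct⁺ : ∀ {xs} → Unique xs → T (distinct xs)
distinct⁺ {[]}     []         = _
distinct⁺ {x ∷ xs} (x∉ ∷ uxs) = T-∧⁺ (¬T⇒T-not x∉xs) (distinct⁺ uxs)
  where
  x∉xs : ¬ T (any (x ≡ᵇ_) xs)
  x∉xs t = All¬⇒¬Any (All.map (λ x≢y t′ → x≢y (≡ᵇ⇒≡ x _ t′)) x∉) (any⁻ (x ≡ᵇ_) xs t)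

_==-true : ∀ a → (a == true) ≡ a
true ==-true  = refl
false ==-true = refl

_==-false : ∀ a → (a == false) ≡ not a
true ==-false  = refl
false ==-false = refl

<ᵇ-true : ∀ {m n} → m < n → (m <ᵇ n) ≡ true
<ᵇ-true m<n = to T-≡ (<⇒<ᵇ m<n)

<ᵇ-false : ∀ {m n} → n ≤ m → (m <ᵇ n) ≡ false
<ᵇ-false {zero}  {zero}  _         = refl
<ᵇ-false {suc m} {zero}  _         = refl
<ᵇ-false {suc m} {suc n} (s≤s n≤m) = <ᵇ-false {m} {n} n≤m

<ᵇ-∧-not-flip : ∀ m n → ((m <ᵇ n) ∧ not (n <ᵇ m)) ≡ (m <ᵇ n)
<ᵇ-∧-not-flip zero    zero    = refl
<ᵇ-∧-not-flip zero    (suc n) = refl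
<ᵇ-∧-not-flip (suc m) zero    = refl
<ᵇ-∧-not-flip (suc m) (suc n) = <ᵇ-∧-not-flip m n

sameOrder : ℕ → ℕ → ℕ × ℕ → Bool
sameOrder x y (x′ , y′) = ((x <ᵇ x′) == (y <ᵇ y′)) ∧ ((x′ <ᵇ x) == (y′ <ᵇ y))

sameOrder-< : ∀ {x y x′ y′} → y < y′ → sameOrder x y (x′ , y′) ≡ (x <ᵇ x′)
sameOrder-< {x} {y} {x′} {y′} y<y′
  rewrite <ᵇ-true y<y′ | <ᵇ-false {y′} {y} (<⇒≤ y<y′) | (x <ᵇ x′) ==-true | (x′ <ᵇ x) ==-false
  = <ᵇ-∧-not-flip x x′

sameOrder-> : ∀ {x y x′ y′} → y′ < y → sameOrder x y (x′ , y′) ≡ (x′ <ᵇ x)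
sameOrder-> {x} {y} {x′} {y′} y′<y
  rewrite <ᵇ-true y′<y | <ᵇ-false {y} {y′} (<⇒≤ y′<y) | (x <ᵇ x′) ==-false | (x′ <ᵇ x) ==-true
  = trans (∧-comm (not (x <ᵇ x′)) (x′ <ᵇ x)) (<ᵇ-∧-not-flip x′ x)

T-sameOrder-> : ∀ {x y x′ y′} → y′ < y → T (sameOrder x y (x′ , y′)) ⇔ x′ < x
T-sameOrder-> {x} {x′ = x′} y′<y rewrite sameOrder-> {x} {x′ = x′} y′<y = mk⇔ (<ᵇ⇒< x′ x) <⇒<ᵇ

Decreasing : List ℕ → Set
Decreasing = AllPairs _>_

all-sameOrder-> : ∀ {x y} xs ys → length xs ≡ length ys → All (y >_) ys →
                  T (all (sameOrder x y) (zip xs ys)) ⇔ All (x >_) xs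
all-sameOrder-> []        []        _   []           = mk⇔ (λ _ → []) (λ _ → _)
all-sameOrder-> {x} {y} (x′ ∷ xs) (y′ ∷ ys) len (y′<y ∷ ys<y) = mk⇔
  (λ h → to (T-sameOrder-> y′<y) (T-∧⁻ˡ h) ∷ to rest (T-∧⁻ʳ h))
  (λ { (x′<x ∷ xs<x) → T-∧⁺ (from (T-sameOrder-> y′<y) x′<x) (from rest xs<x) })
  where rest : T (all (sameOrder x y) (zip xs ys)) ⇔ All (x >_) xs
        rest = all-sameOrder-> xs ys (suc-injective len) ys<y

orderIso-Decreasing : ∀ t s → length t ≡ length s → Decreasing s → T (orderIso t s) ⇔ Decreasing t
orderIso-Decreasing []      []      _   []           = mk⇔ (λ _ → []) (λ _ → _)
orderIso-Decreasing (x ∷ t) (y ∷ s) len (s<y ∷ decS) = mk⇔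
  (λ h → to heads (T-∧⁻ˡ h) ∷ to tails (T-∧⁻ʳ h))
  (λ { (t<x ∷ decT) → T-∧⁺ (from heads t<x) (from tails decT) })
  where heads : T (all (sameOrder x y) (zip t s)) ⇔ All (x >_) t
        heads = all-sameOrder-> t s (suc-injective len) s<y
        tails : T (orderIso t s) ⇔ Decreasing t
        tails = orderIso-Decreasing t s (suc-injective len) decS

length-δ : ∀ k → length (δ k) ≡ k
length-δ k = trans (length-map suc (downFrom k)) (length-downFrom k)

δ-Decreasing : ∀ k → Decreasing (δ k)
δ-Decreasing zero    = []
δ-Decreasing (suc k) = below k ∷ δ-Decreasing k
  where below : ∀ k → All (_< suc k) (δ k)
        below zero    = []
        below (suc k) = ≤-refl ∷ All.map m≤n⇒m≤1+n (below k)

Pattern1342 : ℕ → ℕ → ℕ → ℕ → Set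
Pattern1342 a b c d = a < d × d < b × b < c

orderIso-1342-≡ : ∀ a b c d → orderIso (a ∷ b ∷ c ∷ d ∷ []) p1342 ≡
  ((a <ᵇ b) ∧ ((a <ᵇ c) ∧ ((a <ᵇ d) ∧ true))) ∧
      (((b <ᵇ c) ∧ ((d <ᵇ b) ∧ true)) ∧ (((d <ᵇ c) ∧ true) ∧ (true ∧ true)))
orderIso-1342-≡ a b c d = cong₂ _∧_
  (cong₂ _∧_ (sameOrder-< {a} {x′ = b} 1<3)
      (cong₂ _∧_ (sameOrder-< {a} {x′ = c} 1<4) (cong (_∧ true) (sameOrder-< {a} {x′ = d} 1<2))))
  (cong₂ _∧_ (cong₂ _∧_ (sameOrder-< {b} {x′ = c} 3<4) (cong (_∧ true) (sameOrder-> {b} {x′ = d} 2<3)))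
             (cong (λ z → (z ∧ true) ∧ (true ∧ true)) (sameOrder-> {c} {x′ = d} 2<4)))
  where 1<2 : 1 < 2
        1<2 = s≤s (s≤s z≤n)
        1<3 : 1 < 3
        1<3 = s≤s (s≤s z≤n)
        1<4 : 1 < 4
        1<4 = s≤s (s≤s z≤n)
        2<3 : 2 < 3
        2<3 = s≤s 1<2
        2<4 : 2 < 4
        2<4 = s≤s 1<3
        3<4 : 3 < 4
        3<4 = s≤s 2<3

orderIso-1342 : ∀ a b c d → T (orderIso (a ∷ b ∷ c ∷ d ∷ []) p1342) ⇔ Pattern1342 a b c d
orderIso-1342 a b c d rewrite orderIso-1342-≡ a b c d = mk⇔
  (λ h → let hA = T-∧⁻ˡ {A} h ; hB = T-∧⁻ˡ {B} (T-∧⁻ʳ {A} h) in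
     <ᵇ⇒< a d (T-∧⁻ˡ {a <ᵇ d} (T-∧⁻ʳ {a <ᵇ c} (T-∧⁻ʳ {a <ᵇ b} hA)))
   , <ᵇ⇒< d b (T-∧⁻ˡ {d <ᵇ b} (T-∧⁻ʳ {b <ᵇ c} hB))
   , <ᵇ⇒< b c (T-∧⁻ˡ {b <ᵇ c} hB))
  (λ (a<d , d<b , b<c) →
     let a<b = <-trans a<d d<b in
     T-∧⁺ (T-∧⁺ (<⇒<ᵇ a<b) (T-∧⁺ (<⇒<ᵇ (<-trans a<b b<c)) (T-∧⁺ (<⇒<ᵇ a<d) _)))
          (T-∧⁺ (T-∧⁺ (<⇒<ᵇ b<c) (T-∧⁺ (<⇒<ᵇ d<b) _)) (T-∧⁺ (T-∧⁺ (<⇒<ᵇ (<-trans d<b b<c)) _) _)))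
  where A B : Bool
        A = (a <ᵇ b) ∧ ((a <ᵇ c) ∧ ((a <ᵇ d) ∧ true))
        B = (b <ᵇ c) ∧ ((d <ᵇ b) ∧ true)

module _ {A : Set} where

  AllPairs-resp-⊆ : ∀ {R : A → A → Set} {xs ys} → xs ⊆ ys → AllPairs R ys → AllPairs R xs
  AllPairs-resp-⊆ []         []        = []
  AllPairs-resp-⊆ (_ ∷ʳ p)   (_ ∷ rys) = AllPairs-resp-⊆ p rys
  AllPairs-resp-⊆ (refl ∷ p) (r ∷ rys) = All-resp-⊆ p r ∷ AllPairs-resp-⊆ p rys

  ⊆-++⁻ : ∀ xs {ys t : List A} → t ⊆ xs ++ ys → ∃₂ λ u v → t ≡ u ++ v × u ⊆ xs × v ⊆ ys
  ⊆-++⁻ []       p          = [] , _ , refl , [] , p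
  ⊆-++⁻ (x ∷ xs) (_ ∷ʳ p)   with ⊆-++⁻ xs p
  ... | u , v , refl , u⊆ , v⊆ = u , v , refl , x ∷ʳ u⊆ , v⊆
  ⊆-++⁻ (x ∷ xs) (refl ∷ p) with ⊆-++⁻ xs p
  ... | u , v , refl , u⊆ , v⊆ = x ∷ u , v , refl , refl ∷ u⊆ , v⊆

  ++-⊆⁻ : ∀ u {v c : List A} → u ++ v ⊆ c → ∃₂ λ X Y → c ≡ X ++ Y × u ⊆ X × v ⊆ Y
  ++-⊆⁻ []      p          = [] , _ , refl , [] , p
  ++-⊆⁻ (x ∷ u) (y ∷ʳ p)   with ++-⊆⁻ (x ∷ u) p
  ... | X , Y , refl , u⊆ , v⊆ = y ∷ X , Y , refl , y ∷ʳ u⊆ , v⊆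
  ++-⊆⁻ (x ∷ u) (refl ∷ p) with ++-⊆⁻ u p
  ... | X , Y , refl , u⊆ , v⊆ = x ∷ X , Y , refl , refl ∷ u⊆ , v⊆

  drop-length-++ : ∀ (xs ys : List A) → drop (length xs) (xs ++ ys) ≡ ys
  drop-length-++ []       ys = refl
  drop-length-++ (x ∷ xs) ys = drop-length-++ xs ys

  take-length-++ : ∀ (xs ys : List A) → take (length xs) (xs ++ ys) ≡ xs
  take-length-++ []       ys = refl
  take-length-++ (x ∷ xs) ys = cong (x ∷_) (take-length-++ xs ys)

map-⊆⁻ : ∀ (f : ℕ → ℕ) {t} ys → t ⊆ map f ys → ∃[ t′ ] (t ≡ map f t′ × t′ ⊆ ys)
map-⊆⁻ f []       []         = [] , refl , []
map-⊆⁻ f (y ∷ ys) (_ ∷ʳ p)   with map-⊆⁻ f ys p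
... | t′ , refl , t′⊆ = t′ , refl , y ∷ʳ t′⊆
map-⊆⁻ f (y ∷ ys) (refl ∷ p) with map-⊆⁻ f ys p
... | t′ , refl , t′⊆ = y ∷ t′ , refl , refl ∷ t′⊆

∈-subseqs⁻ : ∀ m s {t} → t ∈ subseqs m s → t ⊆ s × length t ≡ m
∈-subseqs⁻ zero    s        (here refl) = minimum s , refl
∈-subseqs⁻ (suc m) (x ∷ s) t∈ with ∈-++⁻ (map (x ∷_) (subseqs m s)) t∈
... | inj₂ t∈′ = let t⊆ , len = ∈-subseqs⁻ (suc m) s t∈′ in x ∷ʳ t⊆ , len
... | inj₁ t∈′ with ∈-map⁻ (x ∷_) t∈′
... | t′ , t′∈ , refl = let t⊆ , len = ∈-subseqs⁻ m s t′∈ in refl ∷ t⊆ , cong suc len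

∈-subseqs⁺ : ∀ {t s} → t ⊆ s → t ∈ subseqs (length t) s
∈-subseqs⁺ {[]}    _          = here refl
∈-subseqs⁺ {x ∷ t} (y ∷ʳ p)   = ∈-++⁺ʳ (map (y ∷_) (subseqs (length t) _)) (∈-subseqs⁺ p)
∈-subseqs⁺ {x ∷ t} (refl ∷ p) = ∈-++⁺ˡ (∈-map⁺ (x ∷_) (∈-subseqs⁺ p))

contains⁻ : ∀ σ s → T (contains σ s) → ∃[ t ] (t ⊆ s × length t ≡ length σ × T (orderIso t σ))
contains⁻ σ s h with find (any⁻ (λ t → orderIso t σ) (subseqs (length σ) s) h)
... | t , t∈ , iso = t , proj₁ (∈-subseqs⁻ (length σ) s t∈) , proj₂ (∈-subseqs⁻ (length σ) s t∈) , iso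

contains⁺ : ∀ σ {s t} → t ⊆ s → length t ≡ length σ → T (orderIso t σ) → T (contains σ s)
contains⁺ σ {s} {t} t⊆s len iso =
  any⁺ (λ t → orderIso t σ) (lose (subst (t ∈_) (cong (λ m → subseqs m s) len) (∈-subseqs⁺ t⊆s)) iso)

-- Longer decreasing runs are excluded too; this is equivalent and easier to transport.
Avoidsδ : ℕ → List ℕ → Set
Avoidsδ k s = ∀ {t} → t ⊆ s → k ≤ length t → ¬ Decreasing t

avoids-δ⁻ : ∀ k s → T (avoids (δ k) s) → Avoidsδ k s
avoids-δ⁻ k s av {t} t⊆s k≤t dec =
  T-not⇒¬T av (contains⁺ (δ k) (⊆-trans (take-⊆ k t) t⊆s) len
    (from (orderIso-Decreasing (take k t) (δ k) len (δ-Decreasing k)) (AllPairs.take⁺ k dec)))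
  where len : length (take k t) ≡ length (δ k)
        len = trans (length-take k t) (trans (m≤n⇒m⊓n≡m k≤t) (sym (length-δ k)))

avoids-δ⁺ : ∀ k s → Avoidsδ k s → T (avoids (δ k) s)
avoids-δ⁺ k s av = ¬T⇒T-not λ h →
  let t , t⊆s , len , iso = contains⁻ (δ k) s h in
  av t⊆s (≤-reflexive (sym (trans len (length-δ k))))
     (to (orderIso-Decreasing t (δ k) len (δ-Decreasing k)) iso)

Cyclic1342 : List ℕ → Set
Cyclic1342 (a ∷ b ∷ c ∷ d ∷ []) =
  Pattern1342 a b c d ⊎ Pattern1342 b c d a ⊎ Pattern1342 c d a b ⊎ Pattern1342 d a b c
Cyclic1342 _ = ⊥

CyclicallyAvoids1342 : List ℕ → Set
CyclicallyAvoids1342 c = ∀ {t} → t ⊆ c → ¬ Cyclic1342 t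

rotate-1342 : ∀ u v {a b c d} → u ++ v ≡ a ∷ b ∷ c ∷ d ∷ [] → Pattern1342 a b c d → Cyclic1342 (v ++ u)
rotate-1342 []                   v         refl p = inj₁ p
rotate-1342 (_ ∷ [])             v         refl p = inj₂ (inj₂ (inj₂ p))
rotate-1342 (_ ∷ _ ∷ [])         v         refl p = inj₂ (inj₂ (inj₁ p))
rotate-1342 (_ ∷ _ ∷ _ ∷ [])     v         refl p = inj₂ (inj₁ p)
rotate-1342 (_ ∷ _ ∷ _ ∷ _ ∷ []) []        refl p = inj₁ p

∈-rotations⁺ : ∀ c {i} → i < length c → drop i c ++ take i c ∈ rotations c
∈-rotations⁺ c i<c = ∈-map⁺ (λ i → drop i c ++ take i c) (∈-upTo⁺ i<c)

swap-⊆-rotation : ∀ u v {c} → u ++ v ⊆ c → 0 < length v → ∃[ r ] (r ∈ rotations c × v ++ u ⊆ r)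
swap-⊆-rotation u v {c} uv⊆c 0<v with ++-⊆⁻ u uv⊆c
... | X , Y , c≡ , u⊆X , v⊆Y =
  drop (length X) c ++ take (length X) c , ∈-rotations⁺ c X<c , subst (v ++ u ⊆_) rotation≡ (++⁺ v⊆Y u⊆X)
  where
  rotation≡ : Y ++ X ≡ drop (length X) c ++ take (length X) c
  rotation≡ rewrite c≡ = sym (cong₂ _++_ (drop-length-++ X Y) (take-length-++ X Y))
  X<c : length X < length c
  X<c rewrite c≡ | length-++ X {Y} = m<m+n (length X) (<-≤-trans 0<v (length-mono-≤ v⊆Y))

rotations-avoid⁺ : ∀ c → CyclicallyAvoids1342 c → T (all (avoids p1342) (rotations c))
rotations-avoid⁺ c av = all⁻ (avoids p1342) (All.tabulate avoid)
  where
  noOccurrence : ∀ i {t} → t ⊆ drop i c ++ take i c → length t ≡ 4 → ¬ T (orderIso t p1342)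
  noOccurrence i {a ∷ b ∷ c′ ∷ d ∷ []} t⊆ _ iso with ⊆-++⁻ (drop i c) t⊆
  ... | u , v , t≡ , u⊆ , v⊆ =
    av (subst (v ++ u ⊆_) (take++drop≡id i c) (++⁺ v⊆ u⊆))
       (rotate-1342 u v (sym t≡) (to (orderIso-1342 a b c′ d) iso))
  avoid : ∀ {r} → r ∈ rotations c → T (avoids p1342 r)
  avoid r∈ with ∈-map⁻ (λ i → drop i c ++ take i c) r∈
  ... | i , _ , refl = ¬T⇒T-not λ h →
    let t , t⊆ , len , iso = contains⁻ p1342 _ h in noOccurrence i t⊆ len iso

rotation-avoids⇒swap-avoids : ∀ c → T (all (avoids p1342) (rotations c)) →
  ∀ u v → u ++ v ⊆ c → 0 < length v → length (v ++ u) ≡ 4 → ¬ T (orderIso (v ++ u) p1342)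
rotation-avoids⇒swap-avoids c h u v uv⊆c 0<v len iso with swap-⊆-rotation u v uv⊆c 0<v
... | r , r∈ , vu⊆r =
  T-not⇒¬T (All.lookup (all⁺ (avoids p1342) (rotations c) h) r∈) (contains⁺ p1342 vu⊆r len iso)

rotations-avoid⁻ : ∀ c → T (all (avoids p1342) (rotations c)) → CyclicallyAvoids1342 c
rotations-avoid⁻ c h {a ∷ b ∷ c′ ∷ d ∷ []} t⊆c (inj₁ p) =
  rotation-avoids⇒swap-avoids c h [] _ t⊆c (s≤s z≤n) refl (from (orderIso-1342 a b c′ d) p)
rotations-avoid⁻ c h {a ∷ b ∷ c′ ∷ d ∷ []} t⊆c (inj₂ (inj₁ p)) =
  rotation-avoids⇒swap-avoids c h (a ∷ []) _ t⊆c (s≤s z≤n) refl (from (orderIso-1342 b c′ d a) p)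
rotations-avoid⁻ c h {a ∷ b ∷ c′ ∷ d ∷ []} t⊆c (inj₂ (inj₂ (inj₁ p))) =
  rotation-avoids⇒swap-avoids c h (a ∷ b ∷ []) _ t⊆c (s≤s z≤n) refl (from (orderIso-1342 c′ d a b) p)
rotations-avoid⁻ c h {a ∷ b ∷ c′ ∷ d ∷ []} t⊆c (inj₂ (inj₂ (inj₂ p))) =
  rotation-avoids⇒swap-avoids c h (a ∷ b ∷ c′ ∷ []) _ t⊆c (s≤s z≤n) refl (from (orderIso-1342 d a b c′) p)

InRange : ℕ → ℕ → Set
InRange n x = 0 < x × x ≤ n

record IsPermutation (n : ℕ) (π : List ℕ) : Set where
  field
    length≡ : length π ≡ n
    inRange : ∀ {x} → x ∈ π → InRange n x
    unique  : Unique π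

module _ {A : Set} where

  Unique-length-≤ : ∀ {xs ys : List A} → Unique xs → (∀ {x} → x ∈ xs → x ∈ ys) → length xs ≤ length ys
  Unique-length-≤ {[]}     _             _    = z≤n
  Unique-length-≤ {x ∷ xs} (x∉xs ∷ uxs) xs⊆ys with ∈-∃++ (xs⊆ys (here refl))
  ... | ys₁ , ys₂ , refl = ≤-trans (s≤s ih) (≤-reflexive (sym length-with-x))
    where
    remove-x : ∀ {y} → y ∈ ys₁ ++ x ∷ ys₂ → y ≢ x → y ∈ ys₁ ++ ys₂
    remove-x {y} y∈ y≢x with ∈-++⁻ ys₁ y∈
    ... | inj₁ y∈₁         = ∈-++⁺ˡ y∈₁
    ... | inj₂ (here y≡x)  = ⊥-elim (y≢x y≡x)
    ... | inj₂ (there y∈₂) = ∈-++⁺ʳ ys₁ y∈₂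
    ih : length xs ≤ length (ys₁ ++ ys₂)
    ih = Unique-length-≤ uxs λ y∈ → remove-x (xs⊆ys (there y∈)) λ y≡x → All.lookup x∉xs y∈ (sym y≡x)
    length-with-x : length (ys₁ ++ x ∷ ys₂) ≡ suc (length (ys₁ ++ ys₂))
    length-with-x rewrite length-++ ys₁ {x ∷ ys₂} | length-++ ys₁ {ys₂} = +-suc (length ys₁) (length ys₂)

  Unique-map⁺-injectiveOn : ∀ (f : A → A) {xs} → Unique xs →
    (∀ {a b} → a ∈ xs → b ∈ xs → f a ≡ f b → a ≡ b) → Unique (map f xs)
  Unique-map⁺-injectiveOn f {[]}     []          _   = []
  Unique-map⁺-injectiveOn f {x ∷ xs} (x∉xs ∷ uxs) inj =
    All.tabulate distinctImage ∷ Unique-map⁺-injectiveOn f uxs (λ a∈ b∈ → inj (there a∈) (there b∈))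
    where
    distinctImage : ∀ {y} → y ∈ map f xs → f x ≢ y
    distinctImage y∈ fx≡y with ∈-map⁻ f y∈
    ... | a , a∈ , refl = All.lookup x∉xs a∈ (inj (here refl) (there a∈) fx≡y)

  length-≤-injection : ∀ (f : A → A) {xs ys} → Unique xs → (∀ {x} → x ∈ xs → f x ∈ ys) →
    (∀ {a b} → a ∈ xs → b ∈ xs → f a ≡ f b → a ≡ b) → length xs ≤ length ys
  length-≤-injection f {xs} uxs into inj =
    subst (_≤ _) (length-map f xs) (Unique-length-≤ (Unique-map⁺-injectiveOn f uxs inj) image⊆)
    where
    image⊆ : ∀ {y} → y ∈ map f xs → y ∈ _
    image⊆ y∈ with ∈-map⁻ f y∈
    ... | x , x∈ , refl = into x∈

count : {A : Set} → (A → Bool) → List A → ℕ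
count p xs = length (filter (λ x → p x ≟B true) xs)

module _ {A : Set} where

  ∈-count⁻ : ∀ {p : A → Bool} {xs x} → x ∈ filter (λ x → p x ≟B true) xs → x ∈ xs × T (p x)
  ∈-count⁻ {p} x∈ = let x∈xs , px = ∈-filter⁻ (λ x → p x ≟B true) x∈ in x∈xs , from T-≡ px

  ∈-count⁺ : ∀ {p : A → Bool} {xs x} → x ∈ xs → T (p x) → x ∈ filter (λ x → p x ≟B true) xs
  ∈-count⁺ {p} x∈ px = ∈-filter⁺ (λ x → p x ≟B true) x∈ (to T-≡ px)

  count-≤-retraction : ∀ {xs ys : List A} (p q : A → Bool) (f g : A → A) → Unique xs →
    (∀ {x} → x ∈ xs → T (p x) → f x ∈ ys × T (q (f x)) × g (f x) ≡ x) →
    count p xs ≤ count q ys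
  count-≤-retraction {xs} {ys} p q f g uxs fwd =
    length-≤-injection f (Unique.filter⁺ _ uxs) into injective
    where
    into : ∀ {x} → x ∈ filter (λ x → p x ≟B true) xs → f x ∈ filter (λ y → q y ≟B true) ys
    into x∈ = let x∈xs , px = ∈-count⁻ {p} x∈ ; fx∈ , qfx , _ = fwd x∈xs px in ∈-count⁺ {q} fx∈ qfx
    g∘f≡id : ∀ {x} → x ∈ filter (λ x → p x ≟B true) xs → g (f x) ≡ x
    g∘f≡id x∈ = let x∈xs , px = ∈-count⁻ {p} x∈ in proj₂ (proj₂ (fwd x∈xs px))
    injective : ∀ {a b} → a ∈ filter (λ x → p x ≟B true) xs → b ∈ filter (λ x → p x ≟B true) xs →
                f a ≡ f b → a ≡ b
    injective a∈ b∈ fa≡fb = trans (sym (g∘f≡id a∈)) (trans (cong g fa≡fb) (g∘f≡id b∈))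

  count-≡-inverse : ∀ {xs ys : List A} (p q : A → Bool) (f g : A → A) → Unique xs → Unique ys →
    (∀ {x} → x ∈ xs → T (p x) → f x ∈ ys × T (q (f x)) × g (f x) ≡ x) →
    (∀ {y} → y ∈ ys → T (q y) → g y ∈ xs × T (p (g y)) × f (g y) ≡ y) →
    count p xs ≡ count q ys
  count-≡-inverse p q f g uxs uys fwd bwd =
    ≤-antisym (count-≤-retraction p q f g uxs fwd) (count-≤-retraction q p g f uys bwd)

∈-range⁻ : ∀ n {x} → x ∈ map suc (upTo n) → InRange n x
∈-range⁻ n x∈ with ∈-map⁻ suc x∈
... | i , i∈ , refl = s≤s z≤n , ∈-upTo⁻ i∈

∈-range⁺ : ∀ n {x} → InRange n x → x ∈ map suc (upTo n)
∈-range⁺ n {suc x} (_ , s≤s x<n) = ∈-map⁺ suc (∈-upTo⁺ (s≤s x<n))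

∈-words⁻ : ∀ n m {w} → w ∈ words n m → length w ≡ m × (∀ {x} → x ∈ w → InRange n x)
∈-words⁻ n zero    (here refl) = refl , λ ()
∈-words⁻ n (suc m) w∈ with find (∈-concatMap⁻ (λ v → map (v ∷_) (words n m)) {xs = map suc (upTo n)} w∈)
... | v , v∈ , w∈′ with ∈-map⁻ (v ∷_) w∈′
... | w′ , w′∈ , refl = let len , range = ∈-words⁻ n m w′∈ in
  cong suc len , λ { (here refl) → ∈-range⁻ n v∈ ; (there x∈) → range x∈ }

∈-words⁺ : ∀ n m w → length w ≡ m → (∀ {x} → x ∈ w → InRange n x) → w ∈ words n m
∈-words⁺ n zero    []      refl _     = here refl
∈-words⁺ n (suc m) (x ∷ w) len  range =
  ∈-concatMap⁺ (λ v → map (v ∷_) (words n m)) (lose (∈-range⁺ n (range (here refl)))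
    (∈-map⁺ (x ∷_) (∈-words⁺ n m w (suc-injective len) (range ∘ there))))

Unique-words : ∀ n m → Unique (words n m)
Unique-words n zero    = [] ∷ []
Unique-words n (suc m) = prefixes (map suc (upTo n)) (Unique.map⁺ suc-injective (Unique.upTo⁺ n))
  where
  W : List (List ℕ)
  W = words n m
  prefixes : ∀ vs → Unique vs → Unique (concatMap (λ v → map (v ∷_) W) vs)
  prefixes []       _            = []
  prefixes (v ∷ vs) (v∉vs ∷ uvs) =
    Unique.++⁺ (Unique.map⁺ ∷-injectiveʳ (Unique-words n m)) (prefixes vs uvs) disjoint
    where
    disjoint : ∀ {w} → ¬ (w ∈ map (v ∷_) W × w ∈ concatMap (λ v → map (v ∷_) W) vs)
    disjoint (w∈₁ , w∈₂) with ∈-map⁻ (v ∷_) w∈₁ | find (∈-concatMap⁻ (λ v → map (v ∷_) W) {xs = vs} w∈₂)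
    ... | _ , _ , refl | v′ , v′∈ , w∈′ with ∈-map⁻ (v′ ∷_) w∈′
    ... | _ , _ , v∷≡v′∷ = All.lookup v∉vs v′∈ (∷-injectiveˡ v∷≡v′∷)

∈-perms⁻ : ∀ n {π} → π ∈ perms n → IsPermutation n π
∈-perms⁻ n π∈ with ∈-filter⁻ (λ w → distinct w ≟B true) {xs = words n n} π∈
... | π∈words , dist with ∈-words⁻ n n π∈words
... | len , range = record { length≡ = len ; inRange = range ; unique = distinct⁻ _ (from T-≡ dist) }

∈-perms⁺ : ∀ n {π} → IsPermutation n π → π ∈ perms n
∈-perms⁺ n {π} P = ∈-filter⁺ (λ w → distinct w ≟B true)
  (∈-words⁺ n n π (IsPermutation.length≡ P) (IsPermutation.inRange P))
      (to T-≡ (distinct⁺ (IsPermutation.unique P)))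

Unique-perms : ∀ n → Unique (perms n)
Unique-perms n = Unique.filter⁺ (λ w → distinct w ≟B true) (Unique-words n n)

pigeonhole : ∀ n {xs} → Unique xs → (∀ {x} → x ∈ xs → InRange n x) → length xs ≡ n →
             ∀ {v} → InRange n v → v ∈ xs
pigeonhole n {xs} uxs range len {v} v-range with v ∈? xs
... | yes v∈ = v∈
... | no  v∉ = ⊥-elim (<-irrefl refl (subst (_≤ n) (cong suc len) too-long))
  where
  too-long : length (v ∷ xs) ≤ n
  too-long = subst (length (v ∷ xs) ≤_) (trans (length-map suc (upTo n)) (length-upTo n))
    (Unique-length-≤ (All.tabulate (λ x∈ v≡x → v∉ (subst (_∈ xs) (sym v≡x) x∈)) ∷ uxs)
       λ { (here refl) → ∈-range⁺ n v-range ; (there x∈) → ∈-range⁺ n (range x∈) })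

indicator : Bool → ℕ
indicator true  = 1
indicator false = 0

count-∷ : ∀ {A : Set} (p : A → Bool) x xs → count p (x ∷ xs) ≡ indicator (p x) + count p xs
count-∷ p x xs with p x
... | true  = refl
... | false = refl

indicator-¬T : ∀ {b} → ¬ T b → indicator b ≡ 0
indicator-¬T {false} _  = refl
indicator-¬T {true}  ¬t = ⊥-elim (¬t _)

count-none : ∀ {A : Set} (p : A → Bool) xs → (∀ {x} → x ∈ xs → ¬ T (p x)) → count p xs ≡ 0
count-none p []       _    = refl
count-none p (x ∷ xs) none = trans (count-∷ p x xs)
    (cong₂ _+_ (indicator-¬T (none (here refl))) (count-none p xs (none ∘ there)))

sum-map-+ : ∀ (f g : ℕ → ℕ) xs → sum (map (λ v → f v + g v) xs) ≡ sum (map f xs) + sum (map g xs)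
sum-map-+ f g []       = refl
sum-map-+ f g (x ∷ xs) = trans (cong (f x + g x +_) (sum-map-+ f g xs)) (+-interchange (f x) (g x) _ _)

sum-map-zero : ∀ {f : ℕ → ℕ} xs → (∀ {v} → v ∈ xs → f v ≡ 0) → sum (map f xs) ≡ 0
sum-map-zero []       _    = refl
sum-map-zero (x ∷ xs) f≡0 = cong₂ _+_ (f≡0 (here refl)) (sum-map-zero xs (f≡0 ∘ there))

indicator-≡ᵇ-≢ : ∀ {h v} → h ≢ v → indicator (h ≡ᵇ v) ≡ 0
indicator-≡ᵇ-≢ {h} {v} h≢v with h ≡ᵇ v in eq
... | false = refl
... | true  = ⊥-elim (h≢v (≡ᵇ⇒≡ h v (subst T (sym eq) _)))

sum-indicator-≡ᵇ : ∀ {h} vs → Unique vs → h ∈ vs → sum (map (λ v → indicator (h ≡ᵇ v)) vs) ≡ 1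
sum-indicator-≡ᵇ {h} (v ∷ vs) (v∉vs ∷ uvs) (here refl) with h ≡ᵇ h | ≡⇒≡ᵇ h h refl
... | true | _ = cong suc (sum-map-zero vs λ h′∈ → indicator-≡ᵇ-≢ λ h≡h′ → All.lookup v∉vs h′∈ h≡h′)
sum-indicator-≡ᵇ {h} (v ∷ vs) (v∉vs ∷ uvs) (there h∈) =
  cong₂ _+_ (indicator-≡ᵇ-≢ λ h≡v → All.lookup v∉vs h∈ (sym h≡v)) (sum-indicator-≡ᵇ vs uvs h∈)

indicator-by-head : ∀ b π vs → Unique vs → (T b → ∃₂ λ h t → π ≡ h ∷ t × h ∈ vs) →
                    indicator b ≡ sum (map (λ v → indicator (b ∧ firstIs v π)) vs)
indicator-by-head false π vs _   _    = sym (sum-map-zero vs λ _ → refl)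
indicator-by-head true  π vs uvs head with head _
... | h , t , refl , h∈ = sym (sum-indicator-≡ᵇ vs uvs h∈)

count-by-head : ∀ (p : List ℕ → Bool) vs L → Unique vs →
    (∀ {π} → π ∈ L → T (p π) → ∃₂ λ h t → π ≡ h ∷ t × h ∈ vs) →
                count p L ≡ sum (map (λ v → count (λ π → p π ∧ firstIs v π) L) vs)
count-by-head p vs []      _   _     = sym (sum-map-zero vs λ _ → refl)
count-by-head p vs (π ∷ L) uvs heads = begin
  count p (π ∷ L)
    ≡⟨ count-∷ p π L ⟩
  indicator (p π) + count p L
    ≡⟨ cong₂ _+_ (indicator-by-head (p π) π vs uvs (heads (here refl)))
        (count-by-head p vs L uvs (heads ∘ there)) ⟩
  sum (map (λ v → indicator (p π ∧ firstIs v π)) vs) + sum (map (λ v → count (λ π → p π ∧ firstIs v π) L) vs)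
    ≡⟨ sum-map-+ _ _ vs ⟨
  sum (map (λ v → indicator (p π ∧ firstIs v π) + count (λ π → p π ∧ firstIs v π) L) vs)
    ≡⟨ cong sum (map-cong (λ v → count-∷ (λ π → p π ∧ firstIs v π) π L) vs) ⟨
  sum (map (λ v → count (λ π → p π ∧ firstIs v π) (π ∷ L)) vs)
    ∎
  where open ≡-Reasoning

record Good (k : ℕ) (π : List ℕ) : Set where
  field
    cyclic           : Unique (cycleForm π)
    avoidsδ          : Avoidsδ k π
    cyclicallyAvoids : CyclicallyAvoids1342 (cycleForm π)

good⁻ : ∀ k π → T (good k π) → Good k π
good⁻ k π h = record
  { cyclic           = distinct⁻ _ (T-∧⁻ˡ {isCyclic π} h)
  ; avoidsδ          = avoids-δ⁻ k π (T-∧⁻ˡ {avoids (δ k) π} rest)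
  ; cyclicallyAvoids = rotations-avoid⁻ (cycleForm π) (T-∧⁻ʳ {avoids (δ k) π} rest)
  }
  where rest : T (avoids (δ k) π ∧ all (avoids p1342) (rotations (cycleForm π)))
        rest = T-∧⁻ʳ {isCyclic π} h

good⁺ : ∀ {k π} → Good k π → T (good k π)
good⁺ {k} {π} G = T-∧⁺ (distinct⁺ cyclic)
    (T-∧⁺ (avoids-δ⁺ k π avoidsδ) (rotations-avoid⁺ (cycleForm π) cyclicallyAvoids))
  where open Good G

firstIs⁻ : ∀ {v} π → T (firstIs v π) → ∃[ t ] (π ≡ v ∷ t)
firstIs⁻ {v} (x ∷ t) h = t , cong (_∷ t) (≡ᵇ⇒≡ x v h)

firstIs⇒app : ∀ {v} π → T (firstIs v π) → app π 1 ≡ v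
firstIs⇒app {v} (x ∷ t) h = ≡ᵇ⇒≡ x v h

firstIs-∷ : ∀ v t → T (firstIs v (v ∷ t))
firstIs-∷ v t = ≡⇒≡ᵇ v v refl

firstIs-app : ∀ {v π} → 0 < v → app π 1 ≡ v → T (firstIs v π)
firstIs-app {π = []}    () refl
firstIs-app {π = x ∷ t} _  refl = firstIs-∷ x t

app-zero : ∀ l → app l 0 ≡ 0
app-zero []      = refl
app-zero (_ ∷ _) = refl

app-map : ∀ (h : ℕ → ℕ) → h 0 ≡ 0 → ∀ l i → app (map h l) i ≡ h (app l i)
app-map h h0 []      i             = sym h0
app-map h h0 (x ∷ l) zero          = sym h0
app-map h h0 (x ∷ l) (suc zero)    = refl
app-map h h0 (x ∷ l) (suc (suc i)) = app-map h h0 l (suc i)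

app-∈ : ∀ l {i} → InRange (length l) i → app l i ∈ l
app-∈ (x ∷ l) {suc zero}    _              = here refl
app-∈ (x ∷ l) {suc (suc i)} (_ , s≤s i≤l) = there (app-∈ l (s≤s z≤n , i≤l))

app-injective : ∀ l {i j} → Unique l → InRange (length l) i → InRange (length l) j → app l i ≡ app l j → i ≡ j
app-injective (x ∷ l) {suc zero}    {suc zero}    _ _ _ _ = refl
app-injective (x ∷ l) {suc zero}    {suc (suc j)} (x∉l ∷ _) _ (_ , s≤s j≤l) x≡ =
  ⊥-elim (All.lookup x∉l (app-∈ l (s≤s z≤n , j≤l)) x≡)
app-injective (x ∷ l) {suc (suc i)} {suc zero}    (x∉l ∷ _) (_ , s≤s i≤l) _ ≡x =
  ⊥-elim (All.lookup x∉l (app-∈ l (s≤s z≤n , i≤l)) (sym ≡x))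
app-injective (x ∷ l) {suc (suc i)} {suc (suc j)} (_ ∷ ul) (_ , s≤s i≤l) (_ , s≤s j≤l) eq =
  cong suc (app-injective l ul (s≤s z≤n , i≤l) (s≤s z≤n , j≤l) eq)

app-++ˡ : ∀ (xs ys : List ℕ) i → i ≤ length xs → app (xs ++ ys) i ≡ app xs i
app-++ˡ []       ys zero          _         = app-zero ys
app-++ˡ (x ∷ xs) ys zero          _         = refl
app-++ˡ (x ∷ xs) ys (suc zero)    _         = refl
app-++ˡ (x ∷ xs) ys (suc (suc i)) (s≤s i<) = app-++ˡ xs ys (suc i) i<

app-++ʳ : ∀ (xs ys : List ℕ) j → app (xs ++ ys) (length xs + suc j) ≡ app ys (suc j)
app-++ʳ []       ys j = refl
app-++ʳ (x ∷ xs) ys j with length xs + suc j in eq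
... | zero  = ⊥-elim (0≢1+n (trans (sym eq) (+-suc (length xs) j)))
... | suc _ = trans (cong (app (xs ++ ys)) (sym eq)) (app-++ʳ xs ys j)

app-take : ∀ (l : List ℕ) r i → i ≤ r → app (take r l) i ≡ app l i
app-take l       r       zero          _        = trans (app-zero (take r l)) (sym (app-zero l))
app-take []      (suc r) (suc i)       _        = refl
app-take (x ∷ l) (suc r) (suc zero)    _        = refl
app-take (x ∷ l) (suc r) (suc (suc i)) (s≤s i<) = app-take l r (suc i) i<

app-drop : ∀ (l : List ℕ) r j → app (drop r l) (suc j) ≡ app l (r + suc j)
app-drop l       zero    j = refl
app-drop []      (suc r) j = refl
app-drop (x ∷ l) (suc r) j with r + suc j in eq
... | zero  = ⊥-elim (0≢1+n (trans (sym eq) (+-suc r j)))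
... | suc _ = trans (app-drop l r j) (cong (app l) eq)

app-extensionality : ∀ (l₁ l₂ : List ℕ) → length l₁ ≡ length l₂ →
                     (∀ i → InRange (length l₁) i → app l₁ i ≡ app l₂ i) → l₁ ≡ l₂
app-extensionality []       []       _   _  = refl
app-extensionality (x ∷ l₁) (y ∷ l₂) len eq = cong₂ _∷_ (eq 1 (s≤s z≤n , s≤s z≤n))
  (app-extensionality l₁ l₂ (suc-injective len) λ { (suc i) (_ , i≤) → eq (suc (suc i)) (s≤s z≤n , s≤s i≤) })

app-inRange : ∀ {n π c} → IsPermutation n π → InRange n c → InRange n (app π c)
app-inRange {n} {π} {c} P c∈ =
  IsPermutation.inRange P (app-∈ π (subst (λ m → InRange m c) (sym (IsPermutation.length≡ P)) c∈))

iter : List ℕ → ℕ → ℕ → ℕ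
iter π zero    c = c
iter π (suc m) c = iter π m (app π c)

iter-suc : ∀ π m c → iter π (suc m) c ≡ app π (iter π m c)
iter-suc π zero    c = refl
iter-suc π (suc m) c = iter-suc π m (app π c)

iter-+ : ∀ π a b c → iter π (a + b) c ≡ iter π b (iter π a c)
iter-+ π zero    b c = refl
iter-+ π (suc a) b c = iter-+ π a b (app π c)

length-orbit : ∀ π m c → length (orbit π m c) ≡ m
length-orbit π zero    c = refl
length-orbit π (suc m) c = cong suc (length-orbit π m (app π c))

orbit-app : ∀ π m c → orbit π m (app π c) ≡ map (app π) (orbit π m c)
orbit-app π zero    c = refl
orbit-app π (suc m) c = cong (app π c ∷_) (orbit-app π m (app π c))

orbit-+ : ∀ π a b c → orbit π (a + b) c ≡ orbit π a c ++ orbit π b (iter π a c)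
orbit-+ π zero    b c = refl
orbit-+ π (suc a) b c = cong (c ∷_) (orbit-+ π a b (app π c))

orbit-∷ʳ : ∀ π m c → orbit π (suc m) c ≡ orbit π m c ++ iter π m c ∷ []
orbit-∷ʳ π m c = trans (cong (λ k → orbit π k c) (+-comm 1 m)) (orbit-+ π m 1 c)

module _ (π σ : List ℕ) where

  orbit-cong : ∀ m c → (∀ {x} → x ∈ orbit π m c → app π x ≡ app σ x) → orbit π (suc m) c ≡ orbit σ (suc m) c
  orbit-cong zero    c agree = refl
  orbit-cong (suc m) c agree rewrite agree (here refl) =
    cong (c ∷_) (orbit-cong m (app σ c) λ x∈ → agree
        (there (subst (λ d → _ ∈ orbit π m d) (sym (agree (here refl))) x∈)))

  iter-cong : ∀ m c → (∀ {x} → x ∈ orbit π m c → app π x ≡ app σ x) → iter π m c ≡ iter σ m c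
  iter-cong zero    c agree = refl
  iter-cong (suc m) c agree rewrite agree (here refl) =
    iter-cong m (app σ c) λ x∈ → agree (there (subst (λ d → _ ∈ orbit π m d) (sym (agree (here refl))) x∈))

orbit-inRange : ∀ {n π} m {c} → IsPermutation n π → InRange n c → ∀ {x} → x ∈ orbit π m c → InRange n x
orbit-inRange (suc m) P c∈ (here refl) = c∈
orbit-inRange (suc m) P c∈ (there x∈)  = orbit-inRange m P (app-inRange P c∈) x∈

orbit-consecutive : ∀ π m c us a b vs → orbit π m c ≡ us ++ a ∷ b ∷ vs → app π a ≡ b
orbit-consecutive π (suc (suc m)) c []       a b vs eq with ∷-injective eq
... | refl , eq′ = proj₁ (∷-injective eq′)
orbit-consecutive π (suc m)       c (u ∷ us) a b vs eq with ∷-injective eq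
... | refl , eq′ = orbit-consecutive π m (app π c) us a b vs eq′

cycleForm-length : ∀ {m} π → length π ≡ m → cycleForm π ≡ orbit π m 1
cycleForm-length π len = cong (λ m → orbit π m 1) len

Unique-++-disjoint : ∀ xs {ys : List ℕ} {x} → Unique (xs ++ ys) → x ∈ xs → x ∉ ys
Unique-++-disjoint (a ∷ xs) (a∉ ∷ _) (here refl) x∈ys = All.lookup a∉ (∈-++⁺ʳ xs x∈ys) refl
Unique-++-disjoint (a ∷ xs) (_ ∷ u)  (there x∈)  = Unique-++-disjoint xs u x∈

cycle-closes : ∀ m π → IsPermutation (suc m) π → Unique (orbit π (suc m) 1) → app π (iter π m 1) ≡ 1
cycle-closes m π P uC = closes
    (pigeonhole (suc m) uC (orbit-inRange (suc m) P 1∈) (length-orbit π (suc m) 1) (app-inRange P z∈))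
  where
  1∈ : InRange (suc m) 1
  1∈ = s≤s z≤n , s≤s z≤n
  z : ℕ
  z = iter π m 1
  z∈C : z ∈ orbit π (suc m) 1
  z∈C = subst (z ∈_) (sym (orbit-∷ʳ π m 1)) (∈-++⁺ʳ (orbit π m 1) (here refl))
  z∈ : InRange (suc m) z
  z∈ = orbit-inRange (suc m) P 1∈ z∈C
  closes : app π z ∈ orbit π (suc m) 1 → app π z ≡ 1
  closes (here eq)  = eq
  closes (there w∈) with ∈-map⁻ (app π) (subst (app π z ∈_) (orbit-app π m 1) w∈)
  ... | e , e∈ , eq = ⊥-elim (Unique-++-disjoint (orbit π m 1) (subst Unique (orbit-∷ʳ π m 1) uC) e∈ (here e≡z))
    where
    range : ∀ {x} → InRange (suc m) x → InRange (length π) x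
    range = subst (λ l → InRange l _) (sym (IsPermutation.length≡ P))
    e≡z : e ≡ z
    e≡z = app-injective π (IsPermutation.unique P)
            (range (orbit-inRange (suc m) P 1∈ (subst (e ∈_) (sym (orbit-∷ʳ π m 1)) (∈-++⁺ˡ e∈)))) (range z∈)
                (sym eq)

length-cycleForm : ∀ π → length (cycleForm π) ≡ length π
length-cycleForm π = length-orbit π (length π) 1

cycleForm-inRange : ∀ {n π v} → IsPermutation n π → v ∈ cycleForm π → InRange n v
cycleForm-inRange {zero}  {π} {v} P v∈ with subst (v ∈_) (cycleForm-length π (IsPermutation.length≡ P)) v∈
... | ()
cycleForm-inRange {suc m} {π} {v} P v∈ =
  orbit-inRange (suc m) P (s≤s z≤n , s≤s z≤n) (subst (v ∈_) (cycleForm-length π (IsPermutation.length≡ P)) v∈)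

app-split : ∀ l {a b} → 1 ≤ a → a < b → b ≤ length l → ∃[ P ] ∃[ Q ] (l ≡ P ++ app l a ∷ Q × app l b ∈ Q)
app-split (x ∷ l) {suc zero}    {suc zero}    _ (s≤s ()) _
app-split (x ∷ l) {suc zero}    {suc (suc b)} _ _         (s≤s b≤l) = [] , l , refl , app-∈ l (s≤s z≤n , b≤l)
app-split (x ∷ l) {suc (suc a)} {suc (suc b)} _ (s≤s a<b) (s≤s b≤l) with app-split l (s≤s z≤n) a<b b≤l
... | P , Q , l≡ , b∈ = x ∷ P , Q , cong (x ∷_) l≡ , b∈

module _ {f : ℕ → ℕ} (mono : f Preserves _<_ ⟶ _<_) where

  mono-reflects-< : ∀ {x y} → f x < f y → x < y
  mono-reflects-< {x} {y} fx<fy with <-cmp x y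
  ... | tri< x<y _ _    = x<y
  ... | tri≈ _ refl _   = ⊥-elim (<-irrefl refl fx<fy)
  ... | tri> _ _ y<x    = ⊥-elim (<-asym fx<fy (mono y<x))

  Decreasing-map⁺ : ∀ {t} → Decreasing t → Decreasing (map f t)
  Decreasing-map⁺ = AllPairs.map⁺ ∘ AllPairs.map mono

  Decreasing-map⁻ : ∀ {t} → Decreasing (map f t) → Decreasing t
  Decreasing-map⁻ = AllPairs.map mono-reflects-< ∘ AllPairs.map⁻

  Pattern1342-map⁺ : ∀ {a b c d} → Pattern1342 a b c d → Pattern1342 (f a) (f b) (f c) (f d)
  Pattern1342-map⁺ (a<d , d<b , b<c) = mono a<d , mono d<b , mono b<c

  Pattern1342-map⁻ : ∀ {a b c d} → Pattern1342 (f a) (f b) (f c) (f d) → Pattern1342 a b c d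
  Pattern1342-map⁻ (a<d , d<b , b<c) = mono-reflects-< a<d , mono-reflects-< d<b , mono-reflects-< b<c

  Cyclic1342-map⁺ : ∀ t → Cyclic1342 t → Cyclic1342 (map f t)
  Cyclic1342-map⁺ (_ ∷ _ ∷ _ ∷ _ ∷ []) =
    Sum.map Pattern1342-map⁺ (Sum.map Pattern1342-map⁺ (Sum.map Pattern1342-map⁺ Pattern1342-map⁺))

  Cyclic1342-map⁻ : ∀ t → Cyclic1342 (map f t) → Cyclic1342 t
  Cyclic1342-map⁻ (_ ∷ _ ∷ _ ∷ _ ∷ []) =
    Sum.map Pattern1342-map⁻ (Sum.map Pattern1342-map⁻ (Sum.map Pattern1342-map⁻ Pattern1342-map⁻))

-- Permutations starting with 2

-- skip2 maps [n-1] onto [n] ∖ {2}, and insert2 σ puts 2 right after 1 in the cycle of σ.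
skip2 : ℕ → ℕ
skip2 zero          = zero
skip2 (suc zero)    = suc zero
skip2 (suc (suc x)) = suc (suc (suc x))

unskip2 : ℕ → ℕ
unskip2 (suc (suc (suc x))) = suc (suc x)
unskip2 x                   = x

skip2-mono : skip2 Preserves _<_ ⟶ _<_
skip2-mono {zero}        {suc zero}    _         = s≤s z≤n
skip2-mono {zero}        {suc (suc y)} _         = s≤s z≤n
skip2-mono {suc zero}    {suc zero}    (s≤s ())
skip2-mono {suc zero}    {suc (suc y)} _         = s≤s (s≤s z≤n)
skip2-mono {suc (suc x)} {suc (suc y)} (s≤s x<y) = s≤s (s≤s x<y)

skip2-≢2 : ∀ x → skip2 x ≢ 2
skip2-≢2 (suc zero) ()
skip2-≢2 (suc (suc x)) ()

skip2-≡1 : ∀ {x} → skip2 x ≡ 1 → x ≡ 1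
skip2-≡1 {suc zero} _ = refl

skip2-≥2 : ∀ {x} → 2 ≤ x → skip2 x ≡ suc x
skip2-≥2 {suc zero}    (s≤s ())
skip2-≥2 {suc (suc x)} _ = refl

unskip2-skip2 : ∀ x → unskip2 (skip2 x) ≡ x
unskip2-skip2 zero          = refl
unskip2-skip2 (suc zero)    = refl
unskip2-skip2 (suc (suc x)) = refl

skip2-unskip2 : ∀ {x} → x ≢ 2 → skip2 (unskip2 x) ≡ x
skip2-unskip2 {zero}                _   = refl
skip2-unskip2 {suc zero}            _   = refl
skip2-unskip2 {suc (suc zero)}      x≢2 = ⊥-elim (x≢2 refl)
skip2-unskip2 {suc (suc (suc x))}   _   = refl

skip2-injective : ∀ {x y} → skip2 x ≡ skip2 y → x ≡ y
skip2-injective {x} {y} eq = trans (sym (unskip2-skip2 x)) (trans (cong unskip2 eq) (unskip2-skip2 y))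

insert2 : List ℕ → List ℕ
insert2 σ = 2 ∷ map skip2 σ

remove2 : List ℕ → List ℕ
remove2 π = map unskip2 (drop 1 π)

remove2-insert2 : ∀ σ → remove2 (insert2 σ) ≡ σ
remove2-insert2 σ = trans (sym (map-∘ σ)) (map-id-local (All.tabulate λ {x} _ → unskip2-skip2 x))

insert2-isPermutation : ∀ {m σ} → 1 ≤ m → IsPermutation m σ → IsPermutation (suc m) (insert2 σ)
insert2-isPermutation {m} {σ} 1≤m P = record
  { length≡ = cong suc (trans (length-map skip2 σ) length≡)
  ; inRange = range
  ; unique  = All.tabulate (λ y∈ 2≡y → 2∉ (subst (_∈ _) (sym 2≡y) y∈)) ∷ Unique.map⁺ skip2-injective unique
  }
  where
  open IsPermutation P
  range : ∀ {y} → y ∈ insert2 σ → InRange (suc m) y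
  range (here refl) = s≤s z≤n , s≤s 1≤m
  range (there y∈) with ∈-map⁻ skip2 y∈
  ... | suc zero    , _  , refl = s≤s z≤n , s≤s z≤n
  ... | suc (suc x) , x∈ , refl = s≤s z≤n , s≤s (proj₂ (inRange x∈))
  ... | zero        , x∈ , refl with inRange x∈
  ... | () , _
  2∉ : 2 ∉ map skip2 σ
  2∉ 2∈ with ∈-map⁻ skip2 2∈
  ... | x , _ , 2≡ = skip2-≢2 x (sym 2≡)

remove2-isPermutation : ∀ {m t} → 1 ≤ m → IsPermutation (suc m) (2 ∷ t) →
                        IsPermutation m (remove2 (2 ∷ t)) × insert2 (remove2 (2 ∷ t)) ≡ 2 ∷ t
remove2-isPermutation {m} {t} 1≤m P =
  record { length≡ = trans (length-map unskip2 t) (suc-injective length≡) ; inRange = range ; unique = uniq } ,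
  cong (2 ∷_) (trans (sym (map-∘ t)) (map-id-local (All.tabulate (skip2-unskip2 ∘ ≢2))))
  where
  open IsPermutation P
  ≢2 : ∀ {y} → y ∈ t → y ≢ 2
  ≢2 y∈ refl = All.lookup (AllPairs.head unique) y∈ refl
  range : ∀ {y} → y ∈ remove2 (2 ∷ t) → InRange m y
  range y∈ with ∈-map⁻ unskip2 y∈
  ... | zero                , x∈ , refl with inRange (there x∈)
  ... | () , _
  range y∈ | suc zero            , _  , refl = s≤s z≤n , 1≤m
  range y∈ | suc (suc zero)      , x∈ , refl = ⊥-elim (≢2 x∈ refl)
  range y∈ | suc (suc (suc x))   , x∈ , refl = s≤s z≤n , ≤-pred (proj₂ (inRange (there x∈)))
  uniq : Unique (remove2 (2 ∷ t))
  uniq = Unique-map⁺-injectiveOn unskip2 (AllPairs.tail unique) λ a∈ b∈ eq →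
    trans (sym (skip2-unskip2 (≢2 a∈))) (trans (cong skip2 eq) (skip2-unskip2 (≢2 b∈)))

module _ (σ : List ℕ) where

  app-insert2 : ∀ {c} → c ≢ 1 → app (insert2 σ) (skip2 c) ≡ skip2 (app σ c)
  app-insert2 {zero}        _   = cong skip2 (sym (app-zero σ))
  app-insert2 {suc zero}    c≢1 = ⊥-elim (c≢1 refl)
  app-insert2 {suc (suc c)} _   = app-map skip2 refl σ (suc (suc c))

  orbit-insert2 : ∀ j c → 1 ∉ orbit σ j c → orbit (insert2 σ) j (skip2 c) ≡ map skip2 (orbit σ j c)
  orbit-insert2 zero    c _  = refl
  orbit-insert2 (suc j) c 1∉ = cong (skip2 c ∷_)
    (trans (cong (orbit (insert2 σ) j) (app-insert2 λ c≡1 → 1∉ (here (sym c≡1))))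
           (orbit-insert2 j (app σ c) (1∉ ∘ there)))

  1∈orbit-insert2 : ∀ j c → 1 ∈ orbit σ j c → 1 ∈ orbit (insert2 σ) j (skip2 c)
  1∈orbit-insert2 (suc j) c 1∈ with c ≟ 1
  ... | yes refl = here refl
  1∈orbit-insert2 (suc j) c (here 1≡c) | no c≢1 = ⊥-elim (c≢1 (sym 1≡c))
  1∈orbit-insert2 (suc j) c (there 1∈) | no c≢1 =
    there (subst (λ d → 1 ∈ orbit (insert2 σ) j d) (sym (app-insert2 c≢1)) (1∈orbit-insert2 j (app σ c) 1∈))

cycleForm-insert2 : ∀ x r → cycleForm (insert2 (x ∷ r)) ≡ 1 ∷ 2 ∷ orbit (insert2 (x ∷ r)) (length r) (skip2 x)
cycleForm-insert2 x r = cong (λ l → orbit (insert2 (x ∷ r)) (suc (suc l)) 1) (length-map skip2 r)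

Avoidsδ-insert2⁺ : ∀ {k σ} → 3 ≤ k → (∀ {y} → y ∈ σ → 1 ≤ y) → Avoidsδ k σ → Avoidsδ k (insert2 σ)
Avoidsδ-insert2⁺ {σ = σ} _ _ av (_ ∷ʳ t⊆) k≤t dec with map-⊆⁻ skip2 σ t⊆
... | t′ , refl , t′⊆ = av t′⊆ (subst (_ ≤_) (length-map skip2 t′) k≤t) (Decreasing-map⁻ skip2-mono dec)
Avoidsδ-insert2⁺ 3≤k _ _ {_ ∷ []}     (refl ∷ _) k≤t _ with ≤-trans 3≤k k≤t
... | s≤s ()
Avoidsδ-insert2⁺ 3≤k _ _ {_ ∷ _ ∷ []} (refl ∷ _) k≤t _ with ≤-trans 3≤k k≤t
... | s≤s (s≤s ())
Avoidsδ-insert2⁺ {σ = σ} _ σ≥1 _ {_ ∷ a ∷ b ∷ _} (refl ∷ t⊆) _ ((a<2 ∷ _) ∷ (b<a ∷ _) ∷ _)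
  with ∈-map⁻ skip2 (lookup t⊆ (there (here refl)))
... | suc zero    , _ , refl = <-irrefl refl (<-≤-trans a<2 b<a)
... | suc (suc _) , _ , refl = <-asym a<2 (≤-trans (s≤s (s≤s (s≤s z≤n))) b<a)
... | zero        , y∈ , refl with σ≥1 y∈
... | ()

Avoidsδ-insert2⁻ : ∀ {k σ} → Avoidsδ k (insert2 σ) → Avoidsδ k σ
Avoidsδ-insert2⁻ {k} av {t} t⊆ k≤t dec =
  av (2 ∷ʳ map⁺ skip2 t⊆) (subst (k ≤_) (sym (length-map skip2 t)) k≤t) (Decreasing-map⁺ skip2-mono dec)

¬Cyclic1342-1∷2∷ : ∀ {c d} → 2 ≤ c → 2 ≤ d → ¬ Cyclic1342 (1 ∷ 2 ∷ c ∷ d ∷ [])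
¬Cyclic1342-1∷2∷ _   2≤d (inj₁ (_ , d<2 , _))               = <-irrefl refl (<-≤-trans d<2 2≤d)
¬Cyclic1342-1∷2∷ _   _   (inj₂ (inj₁ (s≤s () , _)))
¬Cyclic1342-1∷2∷ 2≤c _   (inj₂ (inj₂ (inj₁ (c<2 , _))))     = <-irrefl refl (<-≤-trans c<2 2≤c)
¬Cyclic1342-1∷2∷ 2≤c _   (inj₂ (inj₂ (inj₂ (_ , c<1 , _)))) = <-irrefl refl
    (<-≤-trans c<1 (≤-trans (s≤s z≤n) 2≤c))

CyclicallyAvoids-insert2⁺ : ∀ X → (∀ {y} → y ∈ X → 2 ≤ y) →
  CyclicallyAvoids1342 (1 ∷ X) → CyclicallyAvoids1342 (1 ∷ 2 ∷ map skip2 X)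
CyclicallyAvoids-insert2⁺ X X≥2 av (_ ∷ʳ (_ ∷ʳ t⊆)) cyc with map-⊆⁻ skip2 X t⊆
... | t′ , refl , t′⊆ = av (1 ∷ʳ t′⊆) (Cyclic1342-map⁻ skip2-mono t′ cyc)
CyclicallyAvoids-insert2⁺ X X≥2 av (_ ∷ʳ (refl ∷ t⊆)) cyc with map-⊆⁻ skip2 X t⊆
... | t′ , refl , t′⊆ = av (refl ∷ t′⊆)
    (Cyclic1342-map⁻ s≤s (1 ∷ t′) (subst (λ l → Cyclic1342 (2 ∷ l)) shift cyc))
  where
  shift : map skip2 t′ ≡ map suc t′
  shift = map-cong-local (All.tabulate λ y∈ → skip2-≥2 (X≥2 (lookup t′⊆ y∈)))
CyclicallyAvoids-insert2⁺ X X≥2 av (refl ∷ (_ ∷ʳ t⊆)) cyc with map-⊆⁻ skip2 X t⊆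
... | t′ , refl , t′⊆ = av (refl ∷ t′⊆) (Cyclic1342-map⁻ skip2-mono (1 ∷ t′) cyc)
CyclicallyAvoids-insert2⁺ X X≥2 av (refl ∷ (refl ∷ t⊆)) cyc with map-⊆⁻ skip2 X t⊆
... | c ∷ d ∷ [] , refl , t′⊆ = ¬Cyclic1342-1∷2∷ (≥2 (here refl)) (≥2 (there (here refl))) cyc
  where
  ≥2 : ∀ {y} → y ∈ c ∷ d ∷ [] → 2 ≤ skip2 y
  ≥2 {y} y∈ = subst (2 ≤_) (sym (skip2-≥2 (X≥2 (lookup t′⊆ y∈))))
      (≤-trans (X≥2 (lookup t′⊆ y∈)) (m≤n⇒m≤1+n ≤-refl))
... | []                  , refl , _ = cyc
... | _ ∷ []              , refl , _ = cyc
... | _ ∷ _ ∷ _ ∷ _       , refl , _ = cyc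

CyclicallyAvoids-insert2⁻ : ∀ X → CyclicallyAvoids1342 (1 ∷ 2 ∷ map skip2 X) → CyclicallyAvoids1342 (1 ∷ X)
CyclicallyAvoids-insert2⁻ X av {t} t⊆ cyc =
  av (⊆-trans (map⁺ skip2 t⊆) (refl ∷ (2 ∷ʳ ⊆-refl))) (Cyclic1342-map⁺ skip2-mono t cyc)

Unique-insert2 : ∀ X → 1 ∉ X → Unique (1 ∷ 2 ∷ map skip2 X) ⇔ Unique (1 ∷ X)
Unique-insert2 X 1∉X = mk⇔
  (λ { (_ ∷ _ ∷ u) → ¬Any⇒All¬ X 1∉X ∷ Unique.map⁻ u })
  (λ { (_ ∷ u) → ((λ ()) ∷ ¬Any⇒All¬ _ 1∉) ∷ ¬Any⇒All¬ _ 2∉ ∷ Unique.map⁺ skip2-injective u })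
  where
  1∉ : 1 ∉ map skip2 X
  1∉ 1∈ with ∈-map⁻ skip2 1∈
  ... | y , y∈ , 1≡ = 1∉X (subst (_∈ X) (skip2-≡1 (sym 1≡)) y∈)
  2∉ : 2 ∉ map skip2 X
  2∉ 2∈ with ∈-map⁻ skip2 2∈
  ... | y , _ , 2≡ = skip2-≢2 y (sym 2≡)

Good-insert2 : ∀ {k m σ} → 3 ≤ k → 1 ≤ m → IsPermutation m σ → Good k (insert2 σ) ⇔ Good k σ
Good-insert2 {σ = []} _ 1≤m P with subst (1 ≤_) (sym (IsPermutation.length≡ P)) 1≤m
... | ()
Good-insert2 {k} {m} {x ∷ r} 3≤k 1≤m P = mk⇔ fromInsert2 toInsert2
  where
  σ : List ℕ
  σ = x ∷ r
  X : List ℕ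
  X = orbit σ (length r) x
  shape : 1 ∉ X → cycleForm (insert2 σ) ≡ 1 ∷ 2 ∷ map skip2 X
  shape 1∉ = trans (cycleForm-insert2 x r) (cong (λ l → 1 ∷ 2 ∷ l) (orbit-insert2 σ (length r) x 1∉))
  X≥2 : 1 ∉ X → ∀ {y} → y ∈ X → 2 ≤ y
  X≥2 1∉ {zero} y∈ with orbit-inRange (suc (length r)) P (s≤s z≤n , 1≤m) (there y∈)
  ... | () , _
  X≥2 1∉ {suc zero}    y∈ = ⊥-elim (1∉ y∈)
  X≥2 1∉ {suc (suc y)} _  = s≤s (s≤s z≤n)
  toInsert2 : Good k σ → Good k (insert2 σ)
  toInsert2 G = record
    { cyclic           = subst Unique (sym (shape 1∉)) (from (Unique-insert2 X 1∉) cyclic)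
    ; avoidsδ          = Avoidsδ-insert2⁺ 3≤k (proj₁ ∘ IsPermutation.inRange P) avoidsδ
    ; cyclicallyAvoids = subst CyclicallyAvoids1342 (sym (shape 1∉))
        (CyclicallyAvoids-insert2⁺ X (X≥2 1∉) cyclicallyAvoids)
    }
    where
    open Good G
    1∉ = Unique.Unique[x∷xs]⇒x∉xs cyclic
  fromInsert2 : Good k (insert2 σ) → Good k σ
  fromInsert2 G = record
    { cyclic           = to (Unique-insert2 X 1∉) (subst Unique (shape 1∉) cyclic)
    ; avoidsδ          = Avoidsδ-insert2⁻ avoidsδ
    ; cyclicallyAvoids = CyclicallyAvoids-insert2⁻ X (subst CyclicallyAvoids1342 (shape 1∉) cyclicallyAvoids)
    }
    where
    open Good G
    1∉ : 1 ∉ X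
    1∉ 1∈ = Unique.Unique[x∷xs]⇒x∉xs (subst Unique (cycleForm-insert2 x r) cyclic)
              (there (1∈orbit-insert2 σ (length r) x 1∈))

count-head-2 : ∀ m k → 1 ≤ m → 3 ≤ k → count (λ π → good k π ∧ firstIs 2 π) (perms (suc m)) ≡ aCirc m k
count-head-2 m k 1≤m 3≤k =
  count-≡-inverse _ (good k) remove2 insert2 (Unique-perms (suc m)) (Unique-perms m) fwd bwd
  where
  fwd : ∀ {π} → π ∈ perms (suc m) → T (good k π ∧ firstIs 2 π) →
        remove2 π ∈ perms m × T (good k (remove2 π)) × insert2 (remove2 π) ≡ π
  fwd {π} π∈ h with firstIs⁻ π (T-∧⁻ʳ {good k π} h)
  ... | t , refl =
    ∈-perms⁺ m P , good⁺ (to (Good-insert2 3≤k 1≤m P) (subst (Good k) (sym inverse) G)) , inverse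
    where
    G : Good k (2 ∷ t)
    G = good⁻ k (2 ∷ t) (T-∧⁻ˡ {good k (2 ∷ t)} h)
    P : IsPermutation m (remove2 (2 ∷ t))
    P = proj₁ (remove2-isPermutation 1≤m (∈-perms⁻ (suc m) π∈))
    inverse : insert2 (remove2 (2 ∷ t)) ≡ 2 ∷ t
    inverse = proj₂ (remove2-isPermutation 1≤m (∈-perms⁻ (suc m) π∈))
  bwd : ∀ {σ} → σ ∈ perms m → T (good k σ) →
        insert2 σ ∈ perms (suc m) × T (good k (insert2 σ) ∧ firstIs 2 (insert2 σ)) × remove2 (insert2 σ) ≡ σ
  bwd {σ} σ∈ h =
    ∈-perms⁺ (suc m) (insert2-isPermutation 1≤m P) ,
    T-∧⁺ (good⁺ (from (Good-insert2 3≤k 1≤m P) (good⁻ k σ h))) _ ,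
    remove2-insert2 σ
    where P : IsPermutation m σ
          P = ∈-perms⁻ m σ∈

-- Permutations starting with r, for 3 ≤ r < n

app-applyUpTo : ∀ (f : ℕ → ℕ) {m i} → i < m → app (applyUpTo f m) (suc i) ≡ f i
app-applyUpTo f {suc m} {zero}  _         = refl
app-applyUpTo f {suc m} {suc i} (s≤s i<m) = app-applyUpTo (f ∘ suc) i<m

AllPairs-from-⊆ : ∀ {R : ℕ → ℕ → Set} xs → (∀ {a b} → a ∷ b ∷ [] ⊆ xs → R a b) → AllPairs R xs
AllPairs-from-⊆ []       _    = []
AllPairs-from-⊆ (x ∷ xs) pair = All.tabulate (λ y∈ → pair (refl ∷ from∈ y∈)) ∷ AllPairs-from-⊆ xs
    (pair ∘ (x ∷ʳ_))

split-below-above : ∀ r R → r ∉ R → (∀ {a b} → a ∷ b ∷ [] ⊆ R → r < a → ¬ b < r) →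
                    ∃₂ λ X Y → R ≡ X ++ Y × All (_< r) X × All (r <_) Y
split-below-above r []      _   _         = [] , [] , refl , [] , []
split-below-above r (a ∷ R) r∉ bigSmall with <-cmp a r
... | tri≈ _ a≡r _ = ⊥-elim (r∉ (here (sym a≡r)))
... | tri< a<r _ _ with split-below-above r R (r∉ ∘ there) (bigSmall ∘ (a ∷ʳ_))
...   | X , Y , refl , X<r , r<Y = a ∷ X , Y , refl , a<r ∷ X<r , r<Y
split-below-above r (a ∷ R) r∉ bigSmall | tri> _ _ r<a =
  [] , a ∷ R , refl , [] , r<a ∷ All.tabulate above
  where
  above : ∀ {b} → b ∈ R → r < b
  above {b} b∈ with <-cmp b r
  ... | tri< b<r _ _ = ⊥-elim (bigSmall (refl ∷ from∈ b∈) r<a b<r)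
  ... | tri≈ _ b≡r _ = ⊥-elim (r∉ (there (subst (_∈ R) b≡r b∈)))
  ... | tri> _ _ r<b = r<b

Decreasing-interval : ∀ r j Y → Decreasing Y → (∀ {y} → y ∈ Y → r < y × y ≤ r + j) →
                      (∀ {v} → r < v → v ≤ r + j → v ∈ Y) → Y ≡ applyDownFrom (λ i → suc (r + i)) j
Decreasing-interval r zero    []      _   _       _        = refl
Decreasing-interval r zero    (y ∷ Y) _   inside  _        =
  ⊥-elim (<-irrefl refl
      (<-≤-trans (proj₁ (inside (here refl))) (subst (y ≤_) (+-identityʳ r) (proj₂ (inside (here refl))))))
Decreasing-interval r (suc j) []      _   _       complete with complete (s≤s (m≤m+n r j))
    (≤-reflexive (sym (+-suc r j)))
... | ()
Decreasing-interval r (suc j) (y ∷ Y) (Y<y ∷ decY) inside complete =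
  cong₂ _∷_ y≡top (Decreasing-interval r j Y decY inside′ complete′)
  where
  top : ℕ
  top = suc (r + j)
  top≤y : top ≤ y
  top≤y with complete (s≤s (m≤m+n r j)) (≤-reflexive (sym (+-suc r j)))
  ... | here top≡y  = ≤-reflexive top≡y
  ... | there top∈ = <⇒≤ (All.lookup Y<y top∈)
  y≡top : y ≡ top
  y≡top = ≤-antisym (subst (y ≤_) (+-suc r j) (proj₂ (inside (here refl)))) top≤y
  inside′ : ∀ {z} → z ∈ Y → r < z × z ≤ r + j
  inside′ z∈ = proj₁ (inside (there z∈)) , ≤-pred (subst (_ <_) y≡top (All.lookup Y<y z∈))
  complete′ : ∀ {v} → r < v → v ≤ r + j → v ∈ Y
  complete′ r<v v≤ with complete r<v (≤-trans v≤ (+-monoʳ-≤ r (n≤1+n j)))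
  ... | here v≡y  = ⊥-elim (<-irrefl refl (subst (_≤ r + j) (trans v≡y y≡top) v≤))
  ... | there v∈ = v∈

++-cancel-length : ∀ (A A′ B B′ : List ℕ) → A ++ B ≡ A′ ++ B′ → length A ≡ length A′ → A ≡ A′ × B ≡ B′
++-cancel-length []      []       B B′ eq _   = refl , eq
++-cancel-length (a ∷ A) (a′ ∷ A′) B B′ eq len with ∷-injective eq
... | refl , eq′ with ++-cancel-length A A′ B B′ eq′ (suc-injective len)
... | refl , B≡ = refl , B≡

Decreasing-in-increasing : ∀ {v L} → AllPairs _<_ L → v ⊆ L → Decreasing v → length v ≤ 1
Decreasing-in-increasing {[]}        _    _   _                 = z≤n
Decreasing-in-increasing {_ ∷ []}    _    _   _                 = ≤-refl
Decreasing-in-increasing {_ ∷ _ ∷ _} incL v⊆L ((b<a ∷ _) ∷ _) with AllPairs-resp-⊆ v⊆L incL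
... | (a<b ∷ _) ∷ _ = ⊥-elim (<-asym a<b b<a)

Decreasing-∷ʳ⁺ : ∀ {t x} → Decreasing t → All (x <_) t → Decreasing (t ++ x ∷ [])
Decreasing-∷ʳ⁺ dec x<t = AllPairs.++⁺ dec ([] ∷ []) (All.map (_∷ []) x<t)

Decreasing-∷ʳ⁻ : ∀ t {x} → Decreasing (t ++ x ∷ []) → All (x <_) t
Decreasing-∷ʳ⁻ []      _            = []
Decreasing-∷ʳ⁻ (y ∷ t) (y>t ∷ dec) = All.lookup y>t (∈-++⁺ʳ t (here refl)) ∷ Decreasing-∷ʳ⁻ t dec

Decreasing-1-last : ∀ {t} → Decreasing t → All (0 <_) t → 1 ∈ t → ∃[ t₀ ] (t ≡ t₀ ++ 1 ∷ [])
Decreasing-1-last {t} dec t>0 1∈ with initLast t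
Decreasing-1-last dec t>0 () | []
... | t₀ ∷ʳ′ w with ∈-++⁻ t₀ 1∈
...   | inj₂ (here refl) = t₀ , refl
...   | inj₁ 1∈t₀        = ⊥-elim (<-irrefl refl (<-≤-trans (All.lookup (Decreasing-∷ʳ⁻ t₀ dec) 1∈t₀)
                                                           (All.lookup t>0 (∈-++⁺ʳ t₀ (here refl)))))

⊆-before : ∀ (P : List ℕ) {Q x t} → Unique (P ++ x ∷ Q) → t ++ x ∷ [] ⊆ P ++ x ∷ Q → t ⊆ P
⊆-before []      {t = []}    _ _          = []
⊆-before []      {t = y ∷ t} u (_ ∷ʳ t⊆) = ⊥-elim
    (Unique.Unique[x∷xs]⇒x∉xs u (lookup t⊆ (there (∈-++⁺ʳ t (here refl)))))
⊆-before []      {t = y ∷ t} u (refl ∷ t⊆) = ⊥-elim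
    (Unique.Unique[x∷xs]⇒x∉xs u (lookup t⊆ (∈-++⁺ʳ t (here refl))))
⊆-before (p ∷ P) {t = []}    _ _          = minimum _
⊆-before (p ∷ P) {t = y ∷ t} (_ ∷ u) (_ ∷ʳ t⊆)   = p ∷ʳ ⊆-before P {t = y ∷ t} u t⊆
⊆-before (p ∷ P) {t = y ∷ t} (_ ∷ u) (refl ∷ t⊆) = refl ∷ ⊆-before P {t = t} u t⊆

-- A cyclic 1342 in 1 r X ++ D can meet D only in its maximum, as a 2134 a b c d;
-- then r a b c is a 4213 in 1 r X.
module _ {r : ℕ} {X : List ℕ} (0<r : 0 < r) (X-range : All (λ x → 0 < x × x < r) X)
    (avC : CyclicallyAvoids1342 (1 ∷ r ∷ X)) where

  private
    C-range : ∀ {x} → x ∈ 1 ∷ r ∷ X → 0 < x × x ≤ r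
    C-range (here refl)         = s≤s z≤n , 0<r
    C-range (there (here refl)) = 0<r , ≤-refl
    C-range (there (there x∈))  = proj₁ (All.lookup X-range x∈) , <⇒≤ (proj₂ (All.lookup X-range x∈))

    ¬2134-prefix : ∀ {a b c} → a ∷ b ∷ c ∷ [] ⊆ 1 ∷ r ∷ X → b < a → a < c → ⊥
    ¬2134-prefix (refl ∷ bc⊆)         b<1 _   = <-irrefl refl
        (<-≤-trans b<1 (proj₁ (C-range (there (lookup bc⊆ (here refl))))))
    ¬2134-prefix (_ ∷ʳ (refl ∷ bc⊆))  _   r<c = <-asym r<c
        (proj₂ (All.lookup X-range (lookup bc⊆ (there (here refl)))))
    ¬2134-prefix (_ ∷ʳ (_ ∷ʳ abc⊆))   b<a a<c =
      avC (1 ∷ʳ (refl ∷ abc⊆))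
          (inj₂ (inj₂ (inj₁ (b<a , a<c , proj₂
              (All.lookup X-range (lookup abc⊆ (there (there (here refl)))))))))

  CyclicallyAvoids-++-descending : ∀ {D} → Decreasing D → All (r <_) D → CyclicallyAvoids1342 (1 ∷ r ∷ X ++ D)
  CyclicallyAvoids-++-descending {D} decD r<D {a ∷ b ∷ c ∷ d ∷ []} t⊆ cyc with ⊆-++⁻ (1 ∷ r ∷ X) t⊆
  ... | u , v , t≡ , u⊆ , v⊆ = split u t≡ u⊆ v⊆ cyc
    where
    below : ∀ {x y} → x ∈ 1 ∷ r ∷ X → y ∈ D → x < y
    below x∈ y∈ = ≤-<-trans (proj₂ (C-range x∈)) (All.lookup r<D y∈)
    split : ∀ u {v} → a ∷ b ∷ c ∷ d ∷ [] ≡ u ++ v → u ⊆ 1 ∷ r ∷ X → v ⊆ D → ¬ Cyclic1342 (a ∷ b ∷ c ∷ d ∷ [])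
    split (_ ∷ _ ∷ _ ∷ _ ∷ []) refl u⊆ _  cyc = avC u⊆ cyc
    split (_ ∷ _ ∷ _ ∷ [])     refl u⊆ v⊆ (inj₁ (_ , d<b , _)) =
      <-asym d<b (below (lookup u⊆ (there (here refl))) (lookup v⊆ (here refl)))
    split (_ ∷ _ ∷ _ ∷ [])     refl u⊆ v⊆ (inj₂ (inj₁ (b<a , a<c , _))) = ¬2134-prefix u⊆ b<a a<c
    split (_ ∷ _ ∷ _ ∷ [])     refl u⊆ v⊆ (inj₂ (inj₂ (inj₁ (_ , _ , d<a)))) =
      <-asym d<a (below (lookup u⊆ (here refl)) (lookup v⊆ (here refl)))
    split (_ ∷ _ ∷ _ ∷ [])     refl u⊆ v⊆ (inj₂ (inj₂ (inj₂ (d<c , _)))) =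
      <-asym d<c (below (lookup u⊆ (there (there (here refl)))) (lookup v⊆ (here refl)))
    split (_ ∷ _ ∷ [])         refl u⊆ v⊆ cyc with cyc | AllPairs-resp-⊆ v⊆ decD
    ... | inj₁ (_ , d<b , _)               | _                = <-asym d<b
        (below (lookup u⊆ (there (here refl))) (lookup v⊆ (there (here refl))))
    ... | inj₂ (inj₁ (_ , _ , c<d))        | (d<c ∷ []) ∷ _   = <-asym c<d d<c
    ... | inj₂ (inj₂ (inj₁ (c<b , _)))     | _                = <-asym c<b
        (below (lookup u⊆ (there (here refl))) (lookup v⊆ (here refl)))
    ... | inj₂ (inj₂ (inj₂ (_ , c<a , _))) | _                = <-asym c<a
        (below (lookup u⊆ (here refl)) (lookup v⊆ (here refl)))
    split (_ ∷ [])             refl u⊆ v⊆ cyc with cyc | AllPairs-resp-⊆ v⊆ decD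
    ... | inj₁ (_ , _ , b<c)               | (c<b ∷ _) ∷ _       = <-asym b<c c<b
    ... | inj₂ (inj₁ (b<a , _))            | _                   = <-asym b<a
        (below (lookup u⊆ (here refl)) (lookup v⊆ (here refl)))
    ... | inj₂ (inj₂ (inj₁ (_ , b<d , _))) | (_ ∷ d<b ∷ _) ∷ _   = <-asym b<d d<b
    ... | inj₂ (inj₂ (inj₂ (_ , c<a , _))) | _                   = <-asym c<a
        (below (lookup u⊆ (here refl)) (lookup v⊆ (there (here refl))))
    split []                   refl _  v⊆ cyc with cyc | AllPairs-resp-⊆ v⊆ decD
    ... | inj₁ (a<d , _)                   | (_ ∷ _ ∷ d<a ∷ _) ∷ _   = <-asym a<d d<a
    ... | inj₂ (inj₁ (_ , a<c , _))        | (_ ∷ c<a ∷ _) ∷ _       = <-asym a<c c<a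
    ... | inj₂ (inj₂ (inj₁ (_ , b<d , _))) | _ ∷ (_ ∷ d<b ∷ _) ∷ _   = <-asym b<d d<b
    ... | inj₂ (inj₂ (inj₂ (_ , _ , a<b))) | (b<a ∷ _) ∷ _           = <-asym a<b b<a
    split (_ ∷ _ ∷ _ ∷ _ ∷ _ ∷ _) () _ _ _

module Extension (q e : ℕ) where

  r : ℕ
  r = suc (suc (suc q))

  n : ℕ
  n = suc (r + e)

  r<n : r < n
  r<n = s≤s (m≤m+n r e)

  above : ℕ → ℕ
  above i = suc (r + i)

  1↦n : ℕ → ℕ
  1↦n (suc zero) = n
  1↦n x          = x

  n↦1 : ℕ → ℕ
  n↦1 x with x ≟ n
  ... | yes _ = 1
  ... | no  _ = x

  1↦n-≢1 : ∀ {x} → x ≢ 1 → 1↦n x ≡ x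
  1↦n-≢1 {zero}        _   = refl
  1↦n-≢1 {suc zero}    x≢1 = ⊥-elim (x≢1 refl)
  1↦n-≢1 {suc (suc x)} _   = refl

  n↦1-n : n↦1 n ≡ 1
  n↦1-n with n ≟ n
  ... | yes _   = refl
  ... | no  n≢n = ⊥-elim (n≢n refl)

  n↦1-≢n : ∀ {x} → x ≢ n → n↦1 x ≡ x
  n↦1-≢n {x} x≢n with x ≟ n
  ... | yes x≡n = ⊥-elim (x≢n x≡n)
  ... | no  _   = refl

  n↦1-inRange : ∀ {w} → 0 < w → (w ≢ n → w ≤ r) → InRange r (n↦1 w)
  n↦1-inRange {w} 0<w ≤r with w ≟ n
  ... | yes _   = s≤s z≤n , s≤s z≤n
  ... | no  w≢n = 0<w , ≤r w≢n

  ≤r⇒≢n : ∀ {x} → x ≤ r → x ≢ n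
  ≤r⇒≢n x≤r refl = <-irrefl refl (≤-<-trans x≤r r<n)

  n↦1∘1↦n : ∀ {x} → x ≤ r → n↦1 (1↦n x) ≡ x
  n↦1∘1↦n {suc zero}    _   = n↦1-n
  n↦1∘1↦n {zero}        x≤r = n↦1-≢n (≤r⇒≢n x≤r)
  n↦1∘1↦n {suc (suc x)} x≤r = n↦1-≢n (≤r⇒≢n x≤r)

  1↦n∘n↦1 : ∀ {x} → x ≢ 1 → 1↦n (n↦1 x) ≡ x
  1↦n∘n↦1 {x} x≢1 with x ≟ n
  ... | yes refl = refl
  ... | no  _    = 1↦n-≢1 x≢1

  suffix : List ℕ
  suffix = 1 ∷ applyUpTo above e

  descent : List ℕ
  descent = applyDownFrom above (suc e)

  extend : List ℕ → List ℕ
  extend σ = map 1↦n σ ++ suffix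

  restrict : List ℕ → List ℕ
  restrict π = map n↦1 (take r π)

  suffix-increasing : AllPairs _<_ suffix
  suffix-increasing = All.tabulate (λ v∈ → above>1 (∈-applyUpTo⁻ above v∈))
                    ∷ AllPairs.applyUpTo⁺₁ above e (λ i<j _ → s≤s (+-monoʳ-< r i<j))
    where above>1 : ∀ {v} → ∃[ i ] (i < e × v ≡ above i) → 1 < v
          above>1 (i , _ , refl) = s≤s (s≤s (≤-trans z≤n (m≤m+n (suc (suc q)) i)))

  descent-decreasing : Decreasing descent
  descent-decreasing = AllPairs.applyDownFrom⁺₁ above (suc e) (λ j<i _ → s≤s (+-monoʳ-< r j<i))

  ∈-descent⁻ : ∀ {v} → v ∈ descent → r < v × v ≤ n
  ∈-descent⁻ v∈ with ∈-applyDownFrom⁻ above v∈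
  ... | i , i≤e , refl = s≤s (m≤m+n r i) , s≤s (+-monoʳ-≤ r (≤-pred i≤e))

  module _ {σ : List ℕ} (length≡ : length σ ≡ r) where

    length-map-1↦n : length (map 1↦n σ) ≡ r
    length-map-1↦n = trans (length-map 1↦n σ) length≡

    length-extend : length (extend σ) ≡ n
    length-extend = begin
      length (map 1↦n σ ++ suffix)
        ≡⟨ length-++ (map 1↦n σ) ⟩
      length (map 1↦n σ) + suc (length (applyUpTo above e))
        ≡⟨ cong₂ (λ a b → a + suc b) length-map-1↦n (length-applyUpTo above e) ⟩
      r + suc e
        ≡⟨ +-suc r e ⟩
      n ∎
      where open ≡-Reasoning

    app-extend-≤r : ∀ {i} → i ≤ r → app (extend σ) i ≡ 1↦n (app σ i)
    app-extend-≤r {i} i≤r = trans (app-++ˡ (map 1↦n σ) suffix i (subst (i ≤_) (sym length-map-1↦n) i≤r))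
                                  (app-map 1↦n refl σ i)

    app-extend-suffix : ∀ j → app (extend σ) (r + suc j) ≡ app suffix (suc j)
    app-extend-suffix j = trans (cong (λ m → app (extend σ) (m + suc j)) (sym length-map-1↦n))
                                (app-++ʳ (map 1↦n σ) suffix j)

    orbit-extend-descent : ∀ j → j ≤ e → orbit (extend σ) (suc j) (above j) ≡ applyDownFrom above (suc j)
    orbit-extend-descent zero    _   = refl
    orbit-extend-descent (suc j) j<e = cong (above (suc j) ∷_)
      (trans (cong (orbit (extend σ) (suc j)) step) (orbit-extend-descent j (<⇒≤ j<e)))
      where
      step : app (extend σ) (above (suc j)) ≡ above j
      step = trans (cong (app (extend σ)) (sym (+-suc r (suc j))))
                   (trans (app-extend-suffix (suc j)) (app-applyUpTo above j<e))

  ∈-suffix⁻ : ∀ {v} → v ∈ suffix → v ≡ 1 ⊎ (r < v × v < n)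
  ∈-suffix⁻ (here refl) = inj₁ refl
  ∈-suffix⁻ (there v∈) with ∈-applyUpTo⁻ above v∈
  ... | i , i<e , refl = inj₂ (s≤s (m≤m+n r i) , s≤s (+-monoʳ-< r i<e))

  1↦n-inRange : ∀ {y} → InRange r y → InRange n (1↦n y)
  1↦n-inRange {suc zero}    _         = s≤s z≤n , ≤-refl
  1↦n-inRange {suc (suc y)} (_ , y≤r) = s≤s z≤n , ≤-trans y≤r (<⇒≤ r<n)

  1↦n∉suffix : ∀ {y} → InRange r y → 1↦n y ∉ suffix
  1↦n∉suffix {suc zero} _ n∈ with ∈-suffix⁻ n∈
  ... | inj₁ ()
  ... | inj₂ (_ , n<n) = <-irrefl refl n<n
  1↦n∉suffix {suc (suc y)} (_ , y≤r) y∈ with ∈-suffix⁻ y∈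
  ... | inj₁ ()
  ... | inj₂ (r<y , _) = <-irrefl refl (<-≤-trans r<y y≤r)

  restrict-extend : ∀ {σ} → IsPermutation r σ → restrict (extend σ) ≡ σ
  restrict-extend {σ} P = begin
    map n↦1 (take r (map 1↦n σ ++ suffix))
      ≡⟨ cong (map n↦1) (subst (λ m → take m (map 1↦n σ ++ suffix) ≡ map 1↦n σ) (length-map-1↦n {σ} length≡)
                                (take-length-++ (map 1↦n σ) suffix)) ⟩
    map n↦1 (map 1↦n σ)
      ≡⟨ map-∘ σ ⟨
    map (n↦1 ∘ 1↦n) σ
      ≡⟨ map-id-local (All.tabulate λ x∈ → n↦1∘1↦n (proj₂ (inRange x∈))) ⟩
    σ ∎
    where open ≡-Reasoning
          open IsPermutation P

  extend-isPermutation : ∀ {σ} → IsPermutation r σ → IsPermutation n (extend σ)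
  extend-isPermutation {σ} P = record
    { length≡ = length-extend {σ} length≡
    ; inRange = range
    ; unique  = Unique.++⁺ (Unique-map⁺-injectiveOn 1↦n unique injective)
                           (AllPairs.map (λ x<y x≡y → <-irrefl x≡y x<y) suffix-increasing) disjoint
    }
    where
    open IsPermutation P
    injective : ∀ {a b} → a ∈ σ → b ∈ σ → 1↦n a ≡ 1↦n b → a ≡ b
    injective a∈ b∈ eq = trans (sym (n↦1∘1↦n (proj₂ (inRange a∈))))
        (trans (cong n↦1 eq) (n↦1∘1↦n (proj₂ (inRange b∈))))
    range : ∀ {x} → x ∈ extend σ → InRange n x
    range x∈ with ∈-++⁻ (map 1↦n σ) x∈
    ... | inj₁ x∈map with ∈-map⁻ 1↦n x∈map
    ... | y , y∈ , refl = 1↦n-inRange (inRange y∈)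
    range x∈ | inj₂ x∈suffix with ∈-suffix⁻ x∈suffix
    ... | inj₁ refl        = s≤s z≤n , s≤s z≤n
    ... | inj₂ (r<x , x<n) = <-trans (s≤s z≤n) r<x , <⇒≤ x<n
    disjoint : ∀ {x} → ¬ (x ∈ map 1↦n σ × x ∈ suffix)
    disjoint (x∈map , x∈suffix) with ∈-map⁻ 1↦n x∈map
    ... | y , y∈ , refl = 1↦n∉suffix (inRange y∈) x∈suffix

  cycleForm-extend : ∀ {σ} → IsPermutation r σ → Unique (cycleForm σ) →
                     cycleForm (extend σ) ≡ cycleForm σ ++ descent
  cycleForm-extend {σ} P uC = begin
    cycleForm (extend σ)
      ≡⟨ cycleForm-length (extend σ) (trans (length-extend {σ} length≡) (sym (+-suc r e))) ⟩
    orbit (extend σ) (r + suc e) 1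
      ≡⟨ orbit-+ (extend σ) r (suc e) 1 ⟩
    orbit (extend σ) r 1 ++ orbit (extend σ) (suc e) (iter (extend σ) r 1)
      ≡⟨ cong₂ _++_ (sym (orbit-cong σ (extend σ) r₀ 1 agree)) (cong (orbit (extend σ) (suc e)) iter≡n) ⟩
    orbit σ r 1 ++ orbit (extend σ) (suc e) n
      ≡⟨ cong₂ _++_ (sym cf≡) (orbit-extend-descent {σ} length≡ e ≤-refl) ⟩
    cycleForm σ ++ descent ∎
    where
    open ≡-Reasoning
    open IsPermutation P
    r₀ : ℕ
    r₀ = suc (suc q)
    cf≡ : cycleForm σ ≡ orbit σ r 1
    cf≡ = cycleForm-length σ length≡
    1∈ : InRange r 1
    1∈ = s≤s z≤n , s≤s z≤n
    early : ∀ {x} → x ∈ orbit σ r₀ 1 → x ∈ orbit σ r 1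
    early {x} x∈ = subst (x ∈_) (sym (orbit-∷ʳ σ r₀ 1)) (∈-++⁺ˡ x∈)
    agree : ∀ {x} → x ∈ orbit σ r₀ 1 → app σ x ≡ app (extend σ) x
    agree {x} x∈ = sym (trans (app-extend-≤r {σ} length≡ (proj₂ (orbit-inRange r P 1∈ (early x∈))))
                              (1↦n-≢1 σx≢1))
      where
      σx≢1 : app σ x ≢ 1
      σx≢1 σx≡1 = Unique.Unique[x∷xs]⇒x∉xs (subst Unique cf≡ uC)
        (subst (_∈ orbit σ r₀ (app σ 1)) σx≡1 (subst (app σ x ∈_) (sym (orbit-app σ r₀ 1)) (∈-map⁺ (app σ) x∈)))
    last : ℕ
    last = iter σ r₀ 1
    last∈ : InRange r last
    last∈ = orbit-inRange r P 1∈ (subst (last ∈_) (sym (orbit-∷ʳ σ r₀ 1)) (∈-++⁺ʳ (orbit σ r₀ 1) (here refl)))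
    iter≡n : iter (extend σ) r 1 ≡ n
    iter≡n = begin
      iter (extend σ) r 1                 ≡⟨ iter-suc (extend σ) r₀ 1 ⟩
      app (extend σ) (iter (extend σ) r₀ 1) ≡⟨ cong (app (extend σ)) (iter-cong σ (extend σ) r₀ 1 agree) ⟨
      app (extend σ) last                 ≡⟨ app-extend-≤r {σ} length≡ (proj₂ last∈) ⟩
      1↦n (app σ last)                    ≡⟨ cong 1↦n (cycle-closes r₀ σ P (subst Unique cf≡ uC)) ⟩
      n                                   ∎

  cycleForm-head-r : ∀ {m π} → length π ≡ suc (suc m) → app π 1 ≡ r → cycleForm π ≡ 1 ∷ r ∷ orbit π m (app π r)
  cycleForm-head-r {m} {π} len π1≡r = trans (cycleForm-length π len) (cong (λ c → 1 ∷ orbit π (suc m) c) π1≡r)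

  cycleForm-split : ∀ {π} → IsPermutation n π → app π 1 ≡ r →
                    Unique (cycleForm π) → CyclicallyAvoids1342 (cycleForm π) →
                    ∃₂ λ X Y → cycleForm π ≡ 1 ∷ r ∷ X ++ Y × All (_< r) X × All (r <_) Y
  cycleForm-split {π} P π1≡r uC avC =
    let X , Y , R≡ , X<r , r<Y = split-below-above r R r∉R bigSmall in
    X , Y , trans C≡ (cong (λ Z → 1 ∷ r ∷ Z) R≡) , X<r , r<Y
    where
    open IsPermutation P
    R : List ℕ
    R = orbit π (suc (suc q) + e) (app π r)
    C≡ : cycleForm π ≡ 1 ∷ r ∷ R
    C≡ = cycleForm-head-r length≡ π1≡r
    uC′ : Unique (1 ∷ r ∷ R)
    uC′ = subst Unique C≡ uC
    r∉R : r ∉ R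
    r∉R = Unique.Unique[x∷xs]⇒x∉xs (AllPairs.tail uC′)
    R>1 : ∀ {v} → v ∈ R → 1 < v
    R>1 {v} v∈ with v ≟ 1
    ... | yes refl = ⊥-elim (Unique.Unique[x∷xs]⇒x∉xs uC′ (there v∈))
    ... | no  v≢1  = ≤∧≢⇒< (proj₁ (cycleForm-inRange P (subst (v ∈_) (sym C≡) (there (there v∈)))))
                            (v≢1 ∘ sym)
    -- 1 r a b would be a 1342.
    bigSmall : ∀ {a b} → a ∷ b ∷ [] ⊆ R → r < a → ¬ b < r
    bigSmall {a} {b} ab⊆ r<a b<r =
      avC (subst (1 ∷ r ∷ a ∷ b ∷ [] ⊆_) (sym C≡) (refl ∷ refl ∷ ab⊆))
          (inj₁ (R>1 (lookup ab⊆ (there (here refl))) , b<r , r<a))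

  cycleShape : ∀ {π} → IsPermutation n π → app π 1 ≡ r →
               Unique (cycleForm π) → CyclicallyAvoids1342 (cycleForm π) →
               ∃[ X ] (All (_< r) X × cycleForm π ≡ 1 ∷ r ∷ X ++ descent)
  cycleShape {π} P π1≡r uC avC with cycleForm-split P π1≡r uC avC
  ... | X , Y , C≡ , X<r , r<Y = X , X<r , trans C≡ (cong (λ Z → 1 ∷ r ∷ X ++ Z) Y≡descent)
    where
    open IsPermutation P
    C : List ℕ
    C = 1 ∷ r ∷ X ++ Y
    uC′ : Unique C
    uC′ = subst Unique C≡ uC
    Y⊆C : Y ⊆ C
    Y⊆C = 1 ∷ʳ (r ∷ʳ ++⁺ˡ X ⊆-refl)
    inRangeC : ∀ {v} → v ∈ C → InRange n v
    inRangeC {v} v∈ = cycleForm-inRange P (subst (v ∈_) (sym C≡) v∈)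
    complete : ∀ {v} → InRange n v → v ∈ C
    complete = pigeonhole n uC′ inRangeC (trans (cong length (sym C≡)) (trans (length-cycleForm π) length≡))
    2∈X : 2 ∈ X
    2∈X with complete (s≤s z≤n , s≤s (s≤s z≤n))
    ... | there (there 2∈) with ∈-++⁻ X 2∈
    ...   | inj₁ 2∈X = 2∈X
    ...   | inj₂ 2∈Y = ⊥-elim (<-asym (All.lookup r<Y 2∈Y) (s≤s (s≤s (s≤s z≤n))))
    -- r 2 a b would be a 2134.
    descendingPair : ∀ {a b} → a ∷ b ∷ [] ⊆ Y → a > b
    descendingPair {a} {b} ab⊆ with <-cmp a b
    ... | tri> _ _ b<a = b<a
    ... | tri≈ _ refl _ = ⊥-elim
        (All.lookup (AllPairs.head (AllPairs-resp-⊆ (⊆-trans ab⊆ Y⊆C) uC′)) (here refl) refl)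
    ... | tri< a<b _ _ = ⊥-elim
        (avC (subst (r ∷ 2 ∷ a ∷ b ∷ [] ⊆_) (sym C≡) (1 ∷ʳ (refl ∷ ++⁺ (from∈ 2∈X) ab⊆)))
             (inj₂ (inj₁ (s≤s (s≤s (s≤s z≤n)) , All.lookup r<Y (lookup ab⊆ (here refl)) , a<b))))
    Y≡descent : Y ≡ descent
    Y≡descent = Decreasing-interval r (suc e) Y (AllPairs-from-⊆ Y descendingPair) inside completeY
      where
      inside : ∀ {y} → y ∈ Y → r < y × y ≤ r + suc e
      inside {y} y∈ = All.lookup r<Y y∈ , subst (y ≤_) (sym (+-suc r e)) (proj₂ (inRangeC (lookup Y⊆C y∈)))
      completeY : ∀ {v} → r < v → v ≤ r + suc e → v ∈ Y
      completeY {v} r<v v≤ with complete (<-trans (s≤s z≤n) r<v , subst (v ≤_) (+-suc r e) v≤)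
      ... | here refl         = ⊥-elim (<-asym r<v (s≤s (s≤s z≤n)))
      ... | there (here refl) = ⊥-elim (<-irrefl refl r<v)
      ... | there (there v∈) with ∈-++⁻ X v∈
      ...   | inj₁ v∈X = ⊥-elim (<-asym r<v (All.lookup X<r v∈X))
      ...   | inj₂ v∈Y = v∈Y

  orbit-descending : ∀ π j {c} → orbit π (suc j) c ≡ applyDownFrom above (suc j) →
                     c ≡ above j × (∀ {i} → i < j → app π (above (suc i)) ≡ above i) × iter π j c ≡ above 0
  orbit-descending π zero    eq = ∷-injectiveˡ eq , (λ ()) , ∷-injectiveˡ eq
  orbit-descending π (suc j) eq with ∷-injective eq
  ... | refl , eq′ with orbit-descending π j eq′
  ... | πc≡ , steps , last = refl , step , last
    where
    step : ∀ {i} → i < suc j → app π (above (suc i)) ≡ above i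
    step (s≤s i≤j) with m≤n⇒m<n∨m≡n i≤j
    ... | inj₁ i<j  = steps i<j
    ... | inj₂ refl = πc≡

  ∈-above⁺ : ∀ {v} → r < v → v < n → v ∈ applyUpTo above e
  ∈-above⁺ {v} r<v v<n = subst (_∈ applyUpTo above e) (m+[n∸m]≡n r<v) (∈-applyUpTo⁺ above i<e)
    where
    i<e : v ∸ suc r < e
    i<e = +-cancelˡ-< r (v ∸ suc r) e (≤-pred (subst (_< n) (sym (m+[n∸m]≡n r<v)) v<n))

  module Restriction {π : List ℕ} (P : IsPermutation n π) (π1≡r : app π 1 ≡ r)
                     (uC : Unique (cycleForm π)) (avC : CyclicallyAvoids1342 (cycleForm π)) where

    open IsPermutation P

    private
      X : List ℕ
      X = proj₁ (cycleShape P π1≡r uC avC)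
      X<r : All (_< r) X
      X<r = proj₁ (proj₂ (cycleShape P π1≡r uC avC))
      C≡ : cycleForm π ≡ 1 ∷ r ∷ X ++ descent
      C≡ = proj₂ (proj₂ (cycleShape P π1≡r uC avC))
      r₀ : ℕ
      r₀ = suc (suc q)

    prefix-length : length (1 ∷ r ∷ X) ≡ r
    prefix-length = +-cancelʳ-≡ (suc e) _ _ (begin
      length (1 ∷ r ∷ X) + suc e               ≡⟨ cong (length (1 ∷ r ∷ X) +_)
          (length-applyDownFrom above (suc e)) ⟨
      length (1 ∷ r ∷ X) + length descent      ≡⟨ length-++ (1 ∷ r ∷ X) ⟨
      length (1 ∷ r ∷ X ++ descent)            ≡⟨ cong length C≡ ⟨
      length (cycleForm π)                     ≡⟨ trans (length-cycleForm π) length≡ ⟩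
      n                                        ≡⟨ +-suc r e ⟨
      r + suc e                                ∎)
      where open ≡-Reasoning

    orbits : orbit π r 1 ≡ 1 ∷ r ∷ X × orbit π (suc e) (iter π r 1) ≡ descent
    orbits = ++-cancel-length _ _ _ _
      (trans (sym (orbit-+ π r (suc e) 1))
          (trans (sym (cycleForm-length π (trans length≡ (sym (+-suc r e))))) C≡))
      (trans (length-orbit π r 1) (sym prefix-length))

    prefix≤r : ∀ {v} → v ∈ orbit π r 1 → v ≤ r
    prefix≤r {v} v∈ with subst (v ∈_) (proj₁ orbits) v∈
    ... | here refl         = s≤s z≤n
    ... | there (here refl) = ≤-refl
    ... | there (there v∈X) = <⇒≤ (All.lookup X<r v∈X)

    descends : iter π r 1 ≡ above e × (∀ {i} → i < e → app π (above (suc i)) ≡ above i) ×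
               iter π e (iter π r 1) ≡ above 0
    descends = orbit-descending π e (proj₂ orbits)

    π-descends : ∀ {i} → i < e → app π (above (suc i)) ≡ above i
    π-descends = proj₁ (proj₂ descends)

    π-after-r : app π (suc r) ≡ 1
    π-after-r = subst (λ z → app π z ≡ 1) iter≡
        (cycle-closes (r + e) π P (subst Unique (cycleForm-length π length≡) uC))
      where
      iter≡ : iter π (r + e) 1 ≡ suc r
      iter≡ = trans (iter-+ π r e 1) (trans (proj₂ (proj₂ descends)) (cong suc (+-identityʳ r)))

    drop≡suffix : drop r π ≡ suffix
    drop≡suffix = app-extensionality (drop r π) suffix len≡ agree
      where
      len≡ : length (drop r π) ≡ length suffix
      len≡ = begin
        length (drop r π)   ≡⟨ length-drop r π ⟩
        length π ∸ r        ≡⟨ cong (_∸ r) (trans length≡ (sym (+-suc r e))) ⟩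
        r + suc e ∸ r       ≡⟨ m+n∸m≡n r (suc e) ⟩
        suc e               ≡⟨ cong suc (length-applyUpTo above e) ⟨
        length suffix       ∎
        where open ≡-Reasoning
      agree : ∀ i → InRange (length (drop r π)) i → app (drop r π) i ≡ app suffix i
      agree (suc zero)    _        = trans (app-drop π r 0) (trans (cong (app π) (+-comm r 1)) π-after-r)
      agree (suc (suc i)) (_ , i<) = begin
        app (drop r π) (suc (suc i))  ≡⟨ app-drop π r (suc i) ⟩
        app π (r + suc (suc i))       ≡⟨ cong (app π) (+-suc r (suc i)) ⟩
        app π (above (suc i))         ≡⟨ π-descends i<e ⟩
        above i                       ≡⟨ app-applyUpTo above i<e ⟨
        app suffix (suc (suc i))      ∎
        where
        open ≡-Reasoning
        i<e : i < e
        i<e = ≤-pred (subst (suc (suc i) ≤_) (trans len≡ (cong suc (length-applyUpTo above e))) i<)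

    private
      take⊎drop : Unique (take r π ++ drop r π)
      take⊎drop = subst Unique (sym (take++drop≡id r π)) unique

      ∈-take-≢1 : ∀ {v} → v ∈ take r π → v ≢ 1
      ∈-take-≢1 v∈ refl = Unique-++-disjoint (take r π) take⊎drop v∈
          (subst (1 ∈_) (sym drop≡suffix) (here refl))

      ∈-take-≤r : ∀ {v} → v ∈ take r π → v ≢ n → v ≤ r
      ∈-take-≤r {v} v∈ v≢n with v ≤? r
      ... | yes v≤r = v≤r
      ... | no  v≰r = ⊥-elim (Unique-++-disjoint (take r π) take⊎drop v∈
                        (subst (v ∈_) (sym drop≡suffix)
                            (there (∈-above⁺ (≰⇒> v≰r)
                                (≤∧≢⇒< (proj₂ (inRange (lookup (take-⊆ r π) v∈))) v≢n)))))

    restrict-isPermutation : IsPermutation r (restrict π)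
    restrict-isPermutation = record
      { length≡ = trans (length-map n↦1 (take r π))
          (trans (length-take r π) (trans (cong (r ⊓_) length≡) (m≤n⇒m⊓n≡m (<⇒≤ r<n))))
      ; inRange = range
      ; unique  = Unique-map⁺-injectiveOn n↦1 (Unique.take⁺ r unique) λ a∈ b∈ eq →
                    trans (sym (1↦n∘n↦1 (∈-take-≢1 a∈))) (trans (cong 1↦n eq) (1↦n∘n↦1 (∈-take-≢1 b∈)))
      }
      where
      range : ∀ {v} → v ∈ restrict π → InRange r v
      range v∈ with ∈-map⁻ n↦1 v∈
      ... | w , w∈ , refl = n↦1-inRange (proj₁ (inRange (lookup (take-⊆ r π) w∈))) (∈-take-≤r w∈)

    extend-restrict : extend (restrict π) ≡ π
    extend-restrict = begin
      map 1↦n (map n↦1 (take r π)) ++ suffix  ≡⟨ cong₂ _++_ (map-∘ (take r π)) drop≡suffix ⟨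
      map (1↦n ∘ n↦1) (take r π) ++ drop r π  ≡⟨ cong (_++ drop r π)
          (map-id-local (All.tabulate (1↦n∘n↦1 ∘ ∈-take-≢1))) ⟩
      take r π ++ drop r π                    ≡⟨ take++drop≡id r π ⟩
      π                                       ∎
      where open ≡-Reasoning

    cycleForm-restrict : cycleForm π ≡ cycleForm (restrict π) ++ descent
    cycleForm-restrict = begin
      cycleForm π                           ≡⟨ C≡ ⟩
      1 ∷ r ∷ X ++ descent                  ≡⟨ cong (_++ descent) (proj₁ orbits) ⟨
      orbit π r 1 ++ descent                ≡⟨ cong (_++ descent) (orbit-cong π (restrict π) r₀ 1 agree) ⟩
      orbit (restrict π) r 1 ++ descent     ≡⟨ cong (_++ descent)
          (cycleForm-length (restrict π) (IsPermutation.length≡ restrict-isPermutation)) ⟨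
      cycleForm (restrict π) ++ descent     ∎
      where
      open ≡-Reasoning
      agree : ∀ {v} → v ∈ orbit π r₀ 1 → app π v ≡ app (restrict π) v
      agree {v} v∈ = sym (begin
        app (map n↦1 (take r π)) v   ≡⟨ app-map n↦1 (n↦1-≢n (λ ())) (take r π) v ⟩
        n↦1 (app (take r π) v)       ≡⟨ cong n↦1
            (app-take π r v (prefix≤r (subst (v ∈_) (sym (orbit-∷ʳ π r₀ 1)) (∈-++⁺ˡ v∈)))) ⟩
        n↦1 (app π v)                ≡⟨ n↦1-≢n (≤r⇒≢n (prefix≤r (there πv∈))) ⟩
        app π v                      ∎)
        where
        πv∈ : app π v ∈ orbit π r₀ (app π 1)
        πv∈ = subst (app π v ∈_) (sym (orbit-app π r₀ 1)) (∈-map⁺ (app π) v∈)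

  cycleForm-after-r : ∀ {σ} → IsPermutation r σ → app σ 1 ≡ r → Unique (cycleForm σ) →
                      cycleForm σ ≡ 1 ∷ r ∷ orbit σ (suc q) (app σ r) ×
                      All (λ x → 1 < x × x < r) (orbit σ (suc q) (app σ r))
  cycleForm-after-r {σ} P σ1≡r uC = C≡ , All.tabulate X-range
    where
    open IsPermutation P
    X : List ℕ
    X = orbit σ (suc q) (app σ r)
    C≡ : cycleForm σ ≡ 1 ∷ r ∷ X
    C≡ = cycleForm-head-r length≡ σ1≡r
    uX : Unique (1 ∷ r ∷ X)
    uX = subst Unique C≡ uC
    X-range : ∀ {x} → x ∈ X → 1 < x × x < r
    X-range {x} x∈ with cycleForm-inRange P (subst (x ∈_) (sym C≡) (there (there x∈)))
    ... | 0<x , x≤r = ≤∧≢⇒< 0<x (λ 1≡x → Unique.Unique[x∷xs]⇒x∉xs uX (there (subst (_∈ X) (sym 1≡x) x∈)))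
                    , ≤∧≢⇒< x≤r (λ x≡r → Unique.Unique[x∷xs]⇒x∉xs (AllPairs.tail uX) (subst (_∈ X) x≡r x∈))

  -- In C(σ) = 1 r X let z be the last entry (σ z = 1) and p the predecessor of 2 (σ p = 2).
  -- Then z < p, for otherwise r p 2 z would be a 4213.
  module _ {σ : List ℕ} (P : IsPermutation r σ) (σ1≡r : app σ 1 ≡ r)
           (uC : Unique (cycleForm σ)) (avC : CyclicallyAvoids1342 (cycleForm σ)) where

    open IsPermutation P

    private
      X : List ℕ
      X = orbit σ (suc q) (app σ r)
      C≡ : cycleForm σ ≡ 1 ∷ r ∷ X
      C≡ = proj₁ (cycleForm-after-r P σ1≡r uC)
      uX : Unique (1 ∷ r ∷ X)
      uX = subst Unique C≡ uC
      avX : CyclicallyAvoids1342 (1 ∷ r ∷ X)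
      avX = subst CyclicallyAvoids1342 C≡ avC

      X-range : ∀ {x} → x ∈ X → 1 < x × x < r
      X-range = All.lookup (proj₂ (cycleForm-after-r P σ1≡r uC))

      2∈X : 2 ∈ X
      2∈X with pigeonhole r uX (cycleForm-inRange P ∘ subst (_ ∈_) (sym C≡))
                 (trans (cong length (sym C≡)) (trans (length-cycleForm σ) length≡))
                 (s≤s z≤n , s≤s (s≤s z≤n))
      ... | there (there 2∈) = 2∈

      z : ℕ
      z = iter σ (suc (suc q)) 1

      z↦1 : app σ z ≡ 1
      z↦1 = cycle-closes (suc (suc q)) σ P (subst Unique (cycleForm-length σ length≡) uC)

      C-last : 1 ∷ r ∷ X ≡ orbit σ (suc (suc q)) 1 ++ z ∷ []
      C-last = trans (sym C≡) (trans (cycleForm-length σ length≡) (orbit-∷ʳ σ (suc (suc q)) 1))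

      z≡2⊎z∈W : ∀ A W → X ≡ A ++ 2 ∷ W → z ≡ 2 ⊎ z ∈ W
      z≡2⊎z∈W A W X≡ with initLast W
      ... | []       = inj₁
          (sym (∷ʳ-injectiveʳ (1 ∷ r ∷ A) (orbit σ (suc (suc q)) 1)
              (trans (cong (λ l → 1 ∷ r ∷ l) (sym X≡)) C-last)))
      ... | W₀ ∷ʳ′ w = inj₂ (subst (_∈ W₀ ++ w ∷ []) (sym z≡w) (∈-++⁺ʳ W₀ (here refl)))
        where
        z≡w : z ≡ w
        z≡w = sym (∷ʳ-injectiveʳ (1 ∷ r ∷ A ++ 2 ∷ W₀) (orbit σ (suc (suc q)) 1)
                (trans (cong (λ l → 1 ∷ r ∷ l) (trans (++-assoc A (2 ∷ W₀) (w ∷ [])) (sym X≡))) C-last))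

      z∈X : z ∈ X
      z∈X with ∈-∃++ 2∈X
      ... | A , W , X≡ with z≡2⊎z∈W A W X≡
      ...   | inj₁ z≡2 = subst (_∈ X) (sym z≡2) 2∈X
      ...   | inj₂ z∈W = subst (z ∈_) (sym X≡) (∈-++⁺ʳ A (there z∈W))

      orbit≡ : ∀ {l} → X ≡ l → orbit σ r 1 ≡ 1 ∷ r ∷ l
      orbit≡ X≡ = trans (sym (cycleForm-length σ length≡)) (trans C≡ (cong (λ l → 1 ∷ r ∷ l) X≡))

      predecessor : ∀ A W → X ≡ A ++ 2 ∷ W → ∃[ p ] (app σ p ≡ 2 × z < p × p ≤ r)
      predecessor A W X≡ with initLast A
      ... | []       = r , orbit-consecutive σ r 1 (1 ∷ []) r 2 W (orbit≡ X≡) , proj₂ (X-range z∈X) , ≤-refl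
      ... | A₀ ∷ʳ′ p =
        p , orbit-consecutive σ r 1 (1 ∷ r ∷ A₀) p 2 W (orbit≡ X≡′) , z<p , <⇒≤ (proj₂ (X-range p∈X))
        where
        X≡′ : X ≡ A₀ ++ p ∷ 2 ∷ W
        X≡′ = trans X≡ (++-assoc A₀ (p ∷ []) (2 ∷ W))
        p∈X : p ∈ X
        p∈X = subst (p ∈_) (sym X≡′) (∈-++⁺ʳ A₀ (here refl))
        p∉ : p ∉ 2 ∷ W
        p∉ = Unique.Unique[x∷xs]⇒x∉xs
            (AllPairs-resp-⊆ (++⁺ˡ A₀ ⊆-refl) (subst Unique X≡′ (AllPairs.tail (AllPairs.tail uX))))
        2<p : 2 < p
        2<p = ≤∧≢⇒< (proj₁ (X-range p∈X)) (λ 2≡p → p∉ (here (sym 2≡p)))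
        z<p : z < p
        z<p with z≡2⊎z∈W (A₀ ++ p ∷ []) W X≡
        ... | inj₁ z≡2 = subst (_< p) (sym z≡2) 2<p
        ... | inj₂ z∈W with <-cmp z p
        ...   | tri< z<p _ _  = z<p
        ...   | tri≈ _ refl _ = ⊥-elim (p∉ (there z∈W))
        ...   | tri> _ _ p<z  = ⊥-elim
            (avX (1 ∷ʳ (refl ∷ subst (p ∷ 2 ∷ z ∷ [] ⊆_) (sym X≡′) (++⁺ˡ A₀ (refl ∷ refl ∷ from∈ z∈W))))
                 (inj₂ (inj₂ (inj₁ (2<p , p<z , proj₂ (X-range z∈X))))))

    1-precedes-2 : ∃₂ λ P Q → σ ≡ P ++ 1 ∷ Q × 2 ∈ Q
    1-precedes-2 with ∈-∃++ 2∈X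
    ... | A , W , X≡ with predecessor A W X≡
    ...   | p , p↦2 , z<p , p≤r
      with app-split σ (≤-trans (s≤s z≤n) (proj₁ (X-range z∈X))) z<p (subst (p ≤_) (sym length≡) p≤r)
    ...     | L , R , σ≡ , 2∈R = L , R , subst (λ v → σ ≡ L ++ v ∷ R) z↦1 σ≡ , subst (_∈ R) p↦2 2∈R

  map-1↦n-id : ∀ {l} → 1 ∉ l → map 1↦n l ≡ l
  map-1↦n-id {l} 1∉ = map-id-local (All.tabulate λ {x} x∈ → 1↦n-≢1 λ x≡1 → 1∉ (subst (_∈ l) x≡1 x∈))

  length-∷ʳ : ∀ (t : List ℕ) x → length (t ++ x ∷ []) ≡ suc (length t)
  length-∷ʳ t x = trans (length-++ t) (+-comm (length t) 1)

  -- A decreasing subsequence of extend σ has at most one entry in the increasing suffix, and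
  -- can contain n = 1↦n 1 only as its head, where it can be replaced by σ₁ = r.
  Avoidsδ-extend⁺ : ∀ {k σ} → IsPermutation r σ → app σ 1 ≡ r → Avoidsδ k σ → Avoidsδ (suc k) (extend σ)
  Avoidsδ-extend⁺ {σ = []} _ ()
  Avoidsδ-extend⁺ {k} {σ@(.r ∷ σ′)} P refl av {t} t⊆ k<t dec with ⊆-++⁻ (map 1↦n σ) t⊆
  ... | u , v , refl , u⊆ , v⊆ with map-⊆⁻ 1↦n σ u⊆
  ... | w , refl , w⊆ = noLongDecreasing w⊆ (AllPairs-resp-⊆ (++⁺ʳ v ⊆-refl) dec) k≤w
    where
    v≤1 : length v ≤ 1
    v≤1 = Decreasing-in-increasing suffix-increasing v⊆ (AllPairs-resp-⊆ (++⁺ˡ (map 1↦n w) ⊆-refl) dec)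
    k≤w : k ≤ length w
    k≤w = ≤-pred (begin
      suc k                           ≤⟨ k<t ⟩
      length (map 1↦n w ++ v)         ≡⟨ length-++ (map 1↦n w) ⟩
      length (map 1↦n w) + length v   ≤⟨ +-monoʳ-≤ (length (map 1↦n w)) v≤1 ⟩
      length (map 1↦n w) + 1          ≡⟨ cong (_+ 1) (length-map 1↦n w) ⟩
      length w + 1                    ≡⟨ +-comm (length w) 1 ⟩
      suc (length w)                  ∎)
      where open ≤-Reasoning
    noLongDecreasing : ∀ {w} → w ⊆ σ → Decreasing (map 1↦n w) → k ≤ length w → ⊥
    noLongDecreasing {[]}     _  _ k≤0 = av (minimum σ) k≤0 []
    noLongDecreasing {h ∷ w′} w⊆ (h>w′ ∷ decW′) k≤w with h ≟ 1
    ... | no h≢1 = av w⊆ k≤w (subst Decreasing (map-1↦n-id 1∉w) (h>w′ ∷ decW′))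
      where
      h≤r : h ≤ r
      h≤r = proj₂ (IsPermutation.inRange P (lookup w⊆ (here refl)))
      1∉w′ : 1 ∉ w′
      1∉w′ 1∈ = <-irrefl refl (<-≤-trans (subst (n <_) (1↦n-≢1 h≢1) (All.lookup h>w′ (∈-map⁺ 1↦n 1∈)))
                                         (≤-trans h≤r (<⇒≤ r<n)))
      1∉w : 1 ∉ h ∷ w′
      1∉w (here 1≡h) = h≢1 (sym 1≡h)
      1∉w (there 1∈) = 1∉w′ 1∈
    ... | yes refl with w⊆
    ...   | () ∷ _
    ...   | _ ∷ʳ w′⊆ = av (refl ∷ ∷ˡ⁻ w′⊆) k≤w (r>w′ ∷ subst Decreasing (map-1↦n-id 1∉w′) decW′)
      where
      open IsPermutation P
      1∉w′ : 1 ∉ w′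
      1∉w′ = Unique.Unique[x∷xs]⇒x∉xs (AllPairs-resp-⊆ w′⊆ (AllPairs.tail unique))
      r>w′ : All (r >_) w′
      r>w′ = All.tabulate λ {x} x∈ →
        ≤∧≢⇒< (proj₂ (inRange (there (lookup w′⊆ (there x∈)))))
              (λ x≡r → All.lookup (AllPairs.head unique) (lookup w′⊆ (there x∈)) (sym x≡r))

  -- A decreasing subsequence of σ ending in 1 may end in 2 instead, as 1 precedes 2,
  -- and can then be extended by the 1 of the suffix.
  Avoidsδ-extend⁻ : ∀ {k σ} → IsPermutation r σ → (∃₂ λ L R → σ ≡ L ++ 1 ∷ R × 2 ∈ R) →
                    Avoidsδ (suc k) (extend σ) → Avoidsδ k σ
  Avoidsδ-extend⁻ {k} {σ} P (L , R , σ≡ , 2∈R) av {t} t⊆ k≤t dec with above1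
    where
    open IsPermutation P
    above1 : ∃[ t₂ ] (t₂ ⊆ σ × length t ≡ length t₂ × Decreasing t₂ × All (1 <_) t₂)
    above1 with 1 ∈? t
    ... | no 1∉t = t , t⊆ , refl , dec , All.tabulate λ {x} x∈ →
                     ≤∧≢⇒< (proj₁ (inRange (lookup t⊆ x∈))) (λ 1≡x → 1∉t (subst (_∈ t) (sym 1≡x) x∈))
    ... | yes 1∈t with Decreasing-1-last dec (All.tabulate (proj₁ ∘ inRange ∘ lookup t⊆)) 1∈t
    ...   | t₀ , refl = t₀ ++ 2 ∷ [] , t₀2⊆ , trans (length-∷ʳ t₀ 1) (sym (length-∷ʳ t₀ 2)) ,
                        Decreasing-∷ʳ⁺ (AllPairs-resp-⊆ (++⁺ʳ _ ⊆-refl) dec) t₀>2 ,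
                        All-++⁺ (All.map (<-trans (s≤s (s≤s z≤n))) t₀>2) (s≤s (s≤s z≤n) ∷ [])
      where
      uLR : Unique (L ++ 1 ∷ R)
      uLR = subst Unique σ≡ unique
      t₀⊆L : t₀ ⊆ L
      t₀⊆L = ⊆-before L uLR (subst (t₀ ++ 1 ∷ [] ⊆_) σ≡ t⊆)
      t₀2⊆ : t₀ ++ 2 ∷ [] ⊆ σ
      t₀2⊆ = subst (t₀ ++ 2 ∷ [] ⊆_) (sym σ≡) (++⁺ t₀⊆L (1 ∷ʳ from∈ 2∈R))
      t₀>2 : All (2 <_) t₀
      t₀>2 = All.tabulate λ {x} x∈ →
        ≤∧≢⇒< (All.lookup (Decreasing-∷ʳ⁻ t₀ dec) x∈)
              (λ 2≡x → Unique-++-disjoint L uLR (lookup t₀⊆L x∈) (there (subst (_∈ R) 2≡x 2∈R)))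
  ... | t₂ , t₂⊆ , len≡ , dec₂ , t₂>1 =
    av (++⁺ (subst (_⊆ map 1↦n σ) (map-1↦n-id 1∉t₂) (map⁺ 1↦n t₂⊆)) (refl ∷ minimum _))
       (subst (suc k ≤_) (sym (length-∷ʳ t₂ 1)) (s≤s (subst (k ≤_) len≡ k≤t)))
       (Decreasing-∷ʳ⁺ dec₂ t₂>1)
    where
    1∉t₂ : 1 ∉ t₂
    1∉t₂ 1∈ = <-irrefl refl (All.lookup t₂>1 1∈)

  Good-extend : ∀ {k σ} → IsPermutation r σ → app σ 1 ≡ r → Good k σ → Good (suc k) (extend σ)
  Good-extend {k} {σ} P σ1≡r G = record
    { cyclic           = subst Unique (sym (cycleForm-extend P cyclic)) (Unique.++⁺ cyclic descent-unique disjoint)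
    ; avoidsδ          = Avoidsδ-extend⁺ P σ1≡r avoidsδ
    ; cyclicallyAvoids = subst CyclicallyAvoids1342
                           (sym (trans (cycleForm-extend P cyclic) (cong (_++ descent) C≡)))
                           (CyclicallyAvoids-++-descending (s≤s z≤n) X-range′
                             (subst CyclicallyAvoids1342 C≡ cyclicallyAvoids)
                             descent-decreasing (All.tabulate (proj₁ ∘ ∈-descent⁻)))
    }
    where
    open Good G
    X : List ℕ
    X = orbit σ (suc q) (app σ r)
    C≡ : cycleForm σ ≡ 1 ∷ r ∷ X
    C≡ = proj₁ (cycleForm-after-r P σ1≡r cyclic)
    X-range′ : All (λ x → 0 < x × x < r) X
    X-range′ = All.map (λ (1<x , x<r) → <-trans (s≤s z≤n) 1<x , x<r) (proj₂ (cycleForm-after-r P σ1≡r cyclic))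
    descent-unique : Unique descent
    descent-unique = AllPairs.map (λ x>y x≡y → <-irrefl (sym x≡y) x>y) descent-decreasing
    disjoint : ∀ {v} → ¬ (v ∈ cycleForm σ × v ∈ descent)
    disjoint (v∈C , v∈D) = <-irrefl refl (≤-<-trans (proj₂ (cycleForm-inRange P v∈C)) (proj₁ (∈-descent⁻ v∈D)))

  Good-restrict : ∀ {k π} → IsPermutation n π → app π 1 ≡ r → Good (suc k) π →
                  IsPermutation r (restrict π) × app (restrict π) 1 ≡ r × Good k (restrict π) ×
                  extend (restrict π) ≡ π
  Good-restrict {k} {π} P π1≡r G = restrict-isPermutation , σ1≡r , record
    { cyclic           = cyclicσ
    ; avoidsδ          = Avoidsδ-extend⁻ restrict-isPermutation
                           (1-precedes-2 restrict-isPermutation σ1≡r cyclicσ avoidsσ)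
                           (subst (Avoidsδ (suc k)) (sym extend-restrict) avoidsδ)
    ; cyclicallyAvoids = avoidsσ
    } , extend-restrict
    where
    open Good G
    open Restriction P π1≡r cyclic cyclicallyAvoids
    prefix : cycleForm (restrict π) ⊆ cycleForm π
    prefix = subst (cycleForm (restrict π) ⊆_) (sym cycleForm-restrict) (++⁺ʳ descent ⊆-refl)
    cyclicσ : Unique (cycleForm (restrict π))
    cyclicσ = AllPairs-resp-⊆ prefix cyclic
    avoidsσ : CyclicallyAvoids1342 (cycleForm (restrict π))
    avoidsσ t⊆ = cyclicallyAvoids (⊆-trans t⊆ prefix)
    σ1≡r : app (restrict π) 1 ≡ r
    σ1≡r = trans (app-map n↦1 (n↦1-≢n (λ ())) (take r π) 1)
                 (trans (cong n↦1 (trans (app-take π r 1 (s≤s z≤n)) π1≡r)) (n↦1-≢n (≤r⇒≢n ≤-refl)))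

  count-head-r : ∀ k → count (λ π → good (suc k) π ∧ firstIs r π) (perms n) ≡ bCirc r k
  count-head-r k = count-≡-inverse _ _ restrict extend (Unique-perms n) (Unique-perms r) fwd bwd
    where
    fwd : ∀ {π} → π ∈ perms n → T (good (suc k) π ∧ firstIs r π) →
          restrict π ∈ perms r × T (good k (restrict π) ∧ firstIs r (restrict π)) × extend (restrict π) ≡ π
    fwd {π} π∈ h =
      let Pσ , σ1≡r , G , inverse = Good-restrict (∈-perms⁻ n π∈) (firstIs⇒app π (T-∧⁻ʳ {good (suc k) π} h))
                                                  (good⁻ (suc k) π (T-∧⁻ˡ {good (suc k) π} h))
      in ∈-perms⁺ r Pσ , T-∧⁺ (good⁺ G) (firstIs-app {π = restrict π} (s≤s z≤n) σ1≡r) , inverse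
    bwd : ∀ {σ} → σ ∈ perms r → T (good k σ ∧ firstIs r σ) →
          extend σ ∈ perms n × T (good (suc k) (extend σ) ∧ firstIs r (extend σ)) × restrict (extend σ) ≡ σ
    bwd {σ} σ∈ h =
      ∈-perms⁺ n (extend-isPermutation P) ,
      T-∧⁺ (good⁺ (Good-extend P σ1≡r (good⁻ k σ (T-∧⁻ˡ {good k σ} h))))
           (firstIs-app {π = extend σ} (s≤s z≤n)
               (trans (app-extend-≤r {σ} (IsPermutation.length≡ P) (s≤s z≤n)) (cong 1↦n σ1≡r))) ,
      restrict-extend P
      where
      P : IsPermutation r σ
      P = ∈-perms⁻ r σ∈
      σ1≡r : app σ 1 ≡ r
      σ1≡r = firstIs⇒app σ (T-∧⁻ʳ {good k σ} h)

fixed-1-not-cyclic : ∀ y t → ¬ Unique (cycleForm (1 ∷ y ∷ t))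
fixed-1-not-cyclic y t ((1≢1 ∷ _) ∷ _) = 1≢1 refl

count-head-0 : ∀ n k → count (λ π → good k π ∧ firstIs 0 π) (perms n) ≡ 0
count-head-0 n k = count-none _ (perms n) λ {π} π∈ h → case π π∈ (firstIs⁻ π (T-∧⁻ʳ {good k π} h))
  where
  case : ∀ π → π ∈ perms n → ∃[ t ] (π ≡ 0 ∷ t) → ⊥
  case _ π∈ (t , refl) with IsPermutation.inRange (∈-perms⁻ n π∈) (here refl)
  ... | () , _

count-head-1 : ∀ n k → 2 ≤ n → count (λ π → good k π ∧ firstIs 1 π) (perms n) ≡ 0
count-head-1 n k 2≤n = count-none _ (perms n) λ {π} π∈ h →
  case π π∈ (firstIs⁻ π (T-∧⁻ʳ {good k π} h)) (Good.cyclic (good⁻ k π (T-∧⁻ˡ {good k π} h)))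
  where
  case : ∀ π → π ∈ perms n → ∃[ t ] (π ≡ 1 ∷ t) → ¬ Unique (cycleForm π)
  case _ π∈ ([] , refl) with subst (2 ≤_) (sym (IsPermutation.length≡ (∈-perms⁻ n π∈))) 2≤n
  ... | s≤s ()
  case _ π∈ (y ∷ t , refl) = fixed-1-not-cyclic y t

head-in-range : ∀ n {π} → 0 < n → π ∈ perms n → ∃₂ λ h t → π ≡ h ∷ t × h ∈ n ∷ upTo n
head-in-range n {[]} 0<n π∈ with subst (0 <_) (sym (IsPermutation.length≡ (∈-perms⁻ n π∈))) 0<n
... | ()
head-in-range n {h ∷ t} 0<n π∈ with IsPermutation.inRange (∈-perms⁻ n π∈) (here refl) | h ≟ n
... | _       | yes refl = h , t , refl , here refl
... | _ , h≤n | no  h≢n  = h , t , refl , there (∈-upTo⁺ (≤∧≢⇒< h≤n h≢n))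

Unique-∷-upTo : ∀ n → Unique (n ∷ upTo n)
Unique-∷-upTo n = All.tabulate (λ i∈ n≡i → <-irrefl (sym n≡i) (∈-upTo⁻ i∈)) ∷ Unique.upTo⁺ n

lemma3p6 : (n k : ℕ) → 5 ≤ n → 4 ≤ k →
    aCirc n k ≡ aCirc (n ∸ 1) k + bCirc n k + sumFromTo 3 (n ∸ 1) (λ r → bCirc r (k ∸ 1))
lemma3p6 n@(suc (suc (suc J))) (suc k) (s≤s (s≤s (s≤s 2≤J))) (s≤s 3≤k) = begin
  aCirc n (suc k)
    ≡⟨ count-by-head (good (suc k)) (n ∷ upTo n) (perms n) (Unique-∷-upTo n)
        (λ π∈ _ → head-in-range n (s≤s z≤n) π∈) ⟩
  c n + (c 0 + (c 1 + (c 2 + sum (map c rest))))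
    ≡⟨ cong₂ (λ z o → c n + (z + (o + (c 2 + sum (map c rest))))) (count-head-0 n (suc k))
        (count-head-1 n (suc k) (s≤s (s≤s z≤n))) ⟩
  bCirc n (suc k) + (c 2 + sum (map c rest))
    ≡⟨ cong₂ (λ a s → bCirc n (suc k) + (a + s))
             (count-head-2 (suc (suc J)) (suc k) (s≤s z≤n) (m≤n⇒m≤1+n 3≤k))
             (cong sum (map-cong-local heads-r)) ⟩
  bCirc n (suc k) + (aCirc (suc (suc J)) (suc k) + S)
    ≡⟨ +-assoc (bCirc n (suc k)) _ S ⟨
  bCirc n (suc k) + aCirc (suc (suc J)) (suc k) + S
    ≡⟨ cong (_+ S) (+-comm (bCirc n (suc k)) _) ⟩
  aCirc (suc (suc J)) (suc k) + bCirc n (suc k) + S ∎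
  where
  open ≡-Reasoning
  c : ℕ → ℕ
  c v = count (λ π → good (suc k) π ∧ firstIs v π) (perms n)
  -- upTo n unfolds to 0 ∷ 1 ∷ 2 ∷ rest, and sumFromTo 3 (n ∸ 1) to a sum over rest.
  rest : List ℕ
  rest = applyUpTo (λ i → 3 + i) J
  S : ℕ
  S = sum (map (λ r → bCirc r k) rest)
  heads-r : All (λ v → c v ≡ bCirc v k) rest
  heads-r = applyUpTo⁺₁ _ J λ {i} i<J →
    subst (λ m → count (λ π → good (suc k) π ∧ firstIs (3 + i) π) (perms m) ≡ bCirc (3 + i) k)
          (cong (3 +_) (m+[n∸m]≡n i<J)) (Extension.count-head-r i (J ∸ suc i) k)
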